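{- Let $m\ge1$, let $\Lambda=(\pmb a;\lambda)$ and $\Omega=(\pmb b;\mu)$ be $m$-partitions of the same degree with $\Lambda$ dominant, i.e. $a_1\ge a_2\ge\cdots\ge a_m$. Then the map $\mathfrak b$ is a well-defined bijection from $\bar{\mathcal S}_{\Lambda\Omega}$ to $\mathcal S_{\Lambda\Omega}$.
   Context: An $m$-partition is $\Lambda=(\pmb a;\lambda)$ with $\pmb a\in\mathbb Z_{\ge0}^m$ and $\lambda$ a partition; $|\Lambda|=|\pmb a|+|\lambda|$. $\pmb a\cup\lambda$ is the partition obtained by sorting the entries of $\pmb a$ and $\lambda$ together in decreasing order. A skew tableau of shape $\nu/\rho$ (English notation) over a totally ordered alphabet is a filling of the skew diagram $\nu/\rho$ weakly increasing along rows (left to right) and strictly increasing down columns. Letters $1<2<\cdots<m$ are ordered as usual, while letters $\bar1,\dots,\bar m$ are ordered by $\bar1>\bar2>\cdots>\bar m$. $\bar{\mathcal S}_{\Lambda\Omega}$ is the set of skew tableaux of shape $\mu/\lambda$ in the letters $\bar1,\dots,\bar m$ in which the letter $\bar i$ appears $a_i-b_i$ times, always within the first $a_i$ columns. $\mathcal S_{\Lambda\Omega}$ is the set of skew tableaux of shape $(\pmb a\cup\lambda)/\mu$ in the letters $1,\dots,m$ in which the letter $i$ appears $b_i$ times, always within the first $a_i$ columns. For $\bar T\in\bar{\mathcal S}_{\Lambda\Omega}$, $\mathfrak b(\bar T)$ is the filling $T$ (columns increasing from top to bottom) such that for every $i$ and every column $c\le a_i$, column $c$ of $T$ contains the letter $i$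 if and only if column $c$ of $\bar T$ does not contain $\bar i$ (and $T$ contains no letter $i$ in columns $c>a_i$). -}

module Defs where

open import Data.Nat as ℕ using (ℕ; zero; suc; _+_; _≤ᵇ_)
open import Data.Fin as Fin using (Fin)
open import Data.Fin.Properties using (_≟_)
open import Data.Bool using (Bool; true; false; if_then_else_; _∧_)
open import Data.List using (List; []; _∷_; length; _++_; foldr)
open import Data.List.Relation.Unary.All using (All)
open import Data.List.Relation.Unary.Linked using (Linked)
open import Data.Vec as Vec using (Vec)
open import Data.Product using (Σ; _×_; ∃)
open import Relation.Nullary using (¬_)
open import Relation.Nullary.Decidable using (⌊_⌋)
open import Relation.Binary.PropositionalEquality using (_≡_)
open import Function.Bundles using (_⇔_)

IsPartition : List ℕ → Set
IsPartition xs = Linked ℕ._≥_ xs × All (λ x → 0 ℕ.< x) xs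

-- r-th part (0-indexed), with 0 beyond the length.
part : List ℕ → ℕ → ℕ
part []       _       = 0
part (x ∷ xs) zero    = x
part (x ∷ xs) (suc r) = part xs r

size : List ℕ → ℕ
size = foldr _+_ 0

insertDesc : ℕ → List ℕ → List ℕ
insertDesc x []       = x ∷ []
insertDesc x (y ∷ ys) = if y ≤ᵇ x then x ∷ y ∷ ys else y ∷ insertDesc x ys

sortDesc : List ℕ → List ℕ
sortDesc = foldr insertDesc []

_∪ₚ_ : ∀ {m} → Vec ℕ m → List ℕ → List ℕ
a ∪ₚ lam = sortDesc (Vec.toList a ++ lam)

-- Fillings: (row, column) ↦ letter, rows and columns 0-indexed.
-- Only the values on the cells of the relevant skew shape matter.
Filling : ℕ → Set
Filling m = ℕ → ℕ → Fin m

InSkew : List ℕ → List ℕ → ℕ → ℕ → Set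
InSkew ν ρ r c = part ρ r ℕ.≤ c × c ℕ.< part ν r

IsSkewTableau : ∀ {m} → (_≤ₐ_ _<ₐ_ : Fin m → Fin m → Set) →
                List ℕ → List ℕ → Filling m → Set
IsSkewTableau _≤ₐ_ _<ₐ_ ν ρ T =
    (∀ r → part ρ r ℕ.≤ part ν r)
  × (∀ r c → InSkew ν ρ r c → InSkew ν ρ r (suc c) → T r c ≤ₐ T r (suc c))
  × (∀ r c → InSkew ν ρ r c → InSkew ν ρ (suc r) c → T r c <ₐ T (suc r) c)

-- Unbarred letters 1 < 2 < ... < m  (letter i+1 encoded as i : Fin m).
UnbarLe UnbarLt : ∀ {m} → Fin m → Fin m → Set
UnbarLe x y = x Fin.≤ y
UnbarLt x y = x Fin.< y

-- Barred letters 1̄ > 2̄ > ... > m̄  (letter (i+1)‾ encoded as i : Fin m).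
BarLe BarLt : ∀ {m} → Fin m → Fin m → Set
BarLe x y = y Fin.≤ x
BarLt x y = y Fin.< x

count : ℕ → (ℕ → Bool) → ℕ
count zero    p = 0
count (suc n) p = count n p + (if p n then 1 else 0)

sumTo : ℕ → (ℕ → ℕ) → ℕ
sumTo zero    f = 0
sumTo (suc n) f = sumTo n f + f n

occ : ∀ {m} → List ℕ → List ℕ → Filling m → Fin m → ℕ
occ ν ρ T i = sumTo (length ν) (λ r →
  count (part ν r) (λ c → (part ρ r ≤ᵇ c) ∧ ⌊ T r c ≟ i ⌋))

WithinCols : ∀ {m} → Vec ℕ m → List ℕ → List ℕ → Filling m → Set
WithinCols a ν ρ T = ∀ i r c → InSkew ν ρ r c → T r c ≡ i → c ℕ.< Vec.lookup a i

-- S̄_{ΛΩ}: skew tableaux of shape μ/λ in barred letters, ī occurring a_i − b_i times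
-- (i.e. occ + b_i = a_i), always in the first a_i columns.
SbarSet : ∀ {m} → Vec ℕ m → List ℕ → Vec ℕ m → List ℕ → Filling m → Set
SbarSet a lam b mu T =
    IsSkewTableau BarLe BarLt mu lam T
  × (∀ i → occ mu lam T i + Vec.lookup b i ≡ Vec.lookup a i)
  × WithinCols a mu lam T

SSet : ∀ {m} → Vec ℕ m → List ℕ → Vec ℕ m → List ℕ → Filling m → Set
SSet a lam b mu T =
    IsSkewTableau UnbarLe UnbarLt (a ∪ₚ lam) mu T
  × (∀ i → occ (a ∪ₚ lam) mu T i ≡ Vec.lookup b i)
  × WithinCols a (a ∪ₚ lam) mu T

ColContains : ∀ {m} → List ℕ → List ℕ → Filling m → ℕ → Fin m → Set
ColContains ν ρ T c i = ∃ λ r → InSkew ν ρ r c × T r c ≡ i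

IsB : ∀ {m} → Vec ℕ m → List ℕ → List ℕ → Filling m → Filling m → Set
IsB a lam mu Tbar T = ∀ i c →
  ColContains (a ∪ₚ lam) mu T c i ⇔ (c ℕ.< Vec.lookup a i × ¬ ColContains mu lam Tbar c i)

SameOn : ∀ {m} → List ℕ → List ℕ → Filling m → Filling m → Set
SameOn ν ρ T T' = ∀ r c → InSkew ν ρ r c → T r c ≡ T' r c

Dominant : ∀ {m} → Vec ℕ m → Set
Dominant a = ∀ i j → i Fin.≤ j → Vec.lookup a j ℕ.≤ Vec.lookup a i

-- Everything happens column by column.  Since a is decreasing, the letters allowed in column c
-- are exactly i < k_c, where k_c is the length of column c of the diagram of a, and column c of
-- a ∪ λ has length k_c + λ'_c.  A column of a tableau is strictly monotone, hence determined by
-- its set of letters; so 𝔟 and its inverse are forced: column c of T is the complement of column c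
-- of T̄ within {i < k_c}, and the lengths μ'_c − λ'_c and k_c + λ'_c − μ'_c add up correctly.  In
-- each of the first a_i columns the letter i lies in exactly one of T̄ and T, which gives the letter
-- counts.  The real content is the row condition: a descent in a row of T (an ascent in a row of T̄)
-- at a letter x makes the numbers of letters below x in two adjacent columns violate the row
-- condition of the other tableau.

module Submission where

open import Defs
open import Data.Nat using (ℕ; zero; suc; _+_; _∸_; _≤_; _<_; _≥_; _≤ᵇ_; _<ᵇ_; _≡ᵇ_; z≤n; s≤s; s≤s⁻¹; _<?_; _≤?_)
open import Data.Nat.Properties hiding (_≟_)
open import Algebra.Properties.CommutativeSemigroup +-commutativeSemigroup using (interchange; xy∙z≈xz∙y; x∙yz≈y∙xz; x∙yz≈yx∙z)
open import Data.Bool as Bool using (Bool; true; false; if_then_else_; _∧_; not)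
open import Data.Bool.Properties using (∧-zeroʳ; ∧-comm; ¬-not)
open import Data.Product using (Σ; _×_; _,_; proj₁; proj₂; ∃)
open import Data.Sum using (_⊎_; inj₁; inj₂)
open import Data.Empty using (⊥; ⊥-elim)
open import Function using (_∘_)
open import Function.Bundles using (_⇔_; mk⇔; Equivalence)
open import Function.Construct.Composition using (_⇔-∘_)
open import Function.Construct.Symmetry using (⇔-sym)
open import Relation.Nullary using (¬_; Dec; yes; no; contradiction)
open import Relation.Nullary.Decidable using (⌊_⌋; decidable-stable)
open import Relation.Binary.Definitions using (tri<; tri≈; tri>)
open import Relation.Binary.PropositionalEquality
open import Data.List using (List; []; _∷_; length; _++_)
open import Data.List.Relation.Unary.Linked as Linked using (Linked; []; [-]; _∷_)
open import Data.Vec as Vec using (Vec; sum)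
open import Data.Vec.Properties using (length-toList)
open import Data.Fin as Fin using (Fin; toℕ)
open import Data.Fin.Properties using (_≟_; toℕ-injective; toℕ<n; toℕ-fromℕ<)

χ : Bool → ℕ
χ b = if b then 1 else 0

χ≤1 : ∀ b → χ b ≤ 1
χ≤1 true  = ≤-refl
χ≤1 false = z≤n

χ-mono : ∀ {a b} → (a ≡ true → b ≡ true) → χ a ≤ χ b
χ-mono {true}  {true}  _ = ≤-refl
χ-mono {true}  {false} f = contradiction (f refl) λ ()
χ-mono {false}         _ = z≤n

≤1⇒≡χ : ∀ n → n ≤ 1 → n ≡ χ (1 ≤ᵇ n)
≤1⇒≡χ zero          _ = refl
≤1⇒≡χ (suc zero)    _ = refl
≤1⇒≡χ (suc (suc n)) (s≤s ())

bool-ext : ∀ {a b : Bool} → (a ≡ true → b ≡ true) → (b ≡ true → a ≡ true) → a ≡ b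
bool-ext {true}  {true}  _ _ = refl
bool-ext {true}  {false} f _ = sym (f refl)
bool-ext {false} {true}  _ g = g refl
bool-ext {false} {false} _ _ = refl

∧-true : ∀ {a b} → a ≡ true → b ≡ true → (a ∧ b) ≡ true
∧-true refl refl = refl

∧-trueˡ : ∀ {a b} → (a ∧ b) ≡ true → a ≡ true
∧-trueˡ {true} _ = refl

∧-trueʳ : ∀ {a b} → (a ∧ b) ≡ true → b ≡ true
∧-trueʳ {true} ab = ab

∧-cong-if : ∀ a {b c} → (a ≡ true → b ≡ c) → (a ∧ b) ≡ (a ∧ c)
∧-cong-if true  b≡c = b≡c refl
∧-cong-if false _   = refl

T⇒≡true : ∀ {b} → Bool.T b → b ≡ true
T⇒≡true {true} _ = refl

≡true⇒T : ∀ {b} → b ≡ true → Bool.T b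
≡true⇒T refl = _

<⇒<ᵇ≡true : ∀ {m n} → m < n → (m <ᵇ n) ≡ true
<⇒<ᵇ≡true = T⇒≡true ∘ <⇒<ᵇ

<ᵇ≡true⇒< : ∀ {m n} → (m <ᵇ n) ≡ true → m < n
<ᵇ≡true⇒< = <ᵇ⇒< _ _ ∘ ≡true⇒T

≮⇒<ᵇ≡false : ∀ {m n} → ¬ m < n → (m <ᵇ n) ≡ false
≮⇒<ᵇ≡false m≮n = ¬-not (m≮n ∘ <ᵇ≡true⇒<)

≤⇒≤ᵇ≡true : ∀ {m n} → m ≤ n → (m ≤ᵇ n) ≡ true
≤⇒≤ᵇ≡true = T⇒≡true ∘ ≤⇒≤ᵇ

≤ᵇ≡true⇒≤ : ∀ {m n} → (m ≤ᵇ n) ≡ true → m ≤ n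
≤ᵇ≡true⇒≤ = ≤ᵇ⇒≤ _ _ ∘ ≡true⇒T

≰⇒≤ᵇ≡false : ∀ {m n} → ¬ m ≤ n → (m ≤ᵇ n) ≡ false
≰⇒≤ᵇ≡false m≰n = ¬-not (m≰n ∘ ≤ᵇ≡true⇒≤)

≡⇒≡ᵇ≡true : ∀ {m n} → m ≡ n → (m ≡ᵇ n) ≡ true
≡⇒≡ᵇ≡true {m} {n} = T⇒≡true ∘ ≡⇒≡ᵇ m n

≡ᵇ≡true⇒≡ : ∀ {m n} → (m ≡ᵇ n) ≡ true → m ≡ n
≡ᵇ≡true⇒≡ = ≡ᵇ⇒≡ _ _ ∘ ≡true⇒T

≢⇒≡ᵇ≡false : ∀ {m n} → m ≢ n → (m ≡ᵇ n) ≡ false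
≢⇒≡ᵇ≡false m≢n = ¬-not (m≢n ∘ ≡ᵇ≡true⇒≡)

∀<-weaken : ∀ {n} {P : ℕ → Set} → (∀ x → x < suc n → P x) → ∀ x → x < n → P x
∀<-weaken h x x<n = h x (m≤n⇒m≤1+n x<n)

-- Counting

count≤n : ∀ n p → count n p ≤ n
count≤n zero    p = z≤n
count≤n (suc n) p = subst (count n p + χ (p n) ≤_) (+-comm n 1) (+-mono-≤ (count≤n n p) (χ≤1 (p n)))

count-mono : ∀ {n n'} p → n ≤ n' → count n p ≤ count n' p
count-mono {n} {zero}   p z≤n = ≤-refl
count-mono {n} {suc n'} p n≤1+n' with m≤n⇒m<n∨m≡n n≤1+n'
... | inj₂ refl      = ≤-refl
... | inj₁ (s≤s n≤n') = ≤-trans (count-mono p n≤n') (m≤m+n (count n' p) _)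

count-cong : ∀ n {p q} → (∀ x → x < n → p x ≡ q x) → count n p ≡ count n q
count-cong zero    h = refl
count-cong (suc n) h = cong₂ _+_ (count-cong n (∀<-weaken h)) (cong χ (h n ≤-refl))

count-+ : ∀ n {p q s} → (∀ x → x < n → χ (p x) + χ (q x) ≡ χ (s x)) →
          count n p + count n q ≡ count n s
count-+ zero    h = refl
count-+ (suc n) {p} {q} h = trans (interchange (count n p) (χ (p n)) (count n q) (χ (q n)))
  (cong₂ _+_ (count-+ n (∀<-weaken h)) (h n ≤-refl))

count-⊆ : ∀ n {p q} → (∀ x → x < n → p x ≡ true → q x ≡ true) → count n p ≤ count n q
count-⊆ zero    h = z≤n
count-⊆ (suc n) h = +-mono-≤ (count-⊆ n (∀<-weaken h)) (χ-mono (h n ≤-refl))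

count-none : ∀ n {p} → (∀ x → x < n → p x ≡ false) → count n p ≡ 0
count-none zero    h = refl
count-none (suc n) h rewrite h n ≤-refl | count-none n (∀<-weaken h) = refl

count-all : ∀ n {p} → (∀ x → x < n → p x ≡ true) → count n p ≡ n
count-all zero    h = refl
count-all (suc n) h rewrite h n ≤-refl | count-all n (∀<-weaken h) = +-comm n 1

count-pos⇒∃ : ∀ n p → 1 ≤ count n p → ∃ λ x → x < n × p x ≡ true
count-pos⇒∃ zero    p ()
count-pos⇒∃ (suc n) p pos with p n in pn
... | true  = n , ≤-refl , pn
... | false with count-pos⇒∃ n p (subst (1 ≤_) (+-identityʳ (count n p)) pos)
...   | x , x<n , px = x , m≤n⇒m≤1+n x<n , px

∃⇒count-pos : ∀ n p x → x < n → p x ≡ true → 1 ≤ count n p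
∃⇒count-pos (suc n) p x x<1+n px with m<1+n⇒m<n∨m≡n x<1+n
... | inj₂ refl rewrite px = m≤n+m 1 (count n p)
... | inj₁ x<n = ≤-trans (∃⇒count-pos n p x x<n px) (m≤m+n (count n p) _)

count-suc-true : ∀ y P → P y ≡ true → count (suc y) P ≡ suc (count y P)
count-suc-true y P Py rewrite Py = +-comm (count y P) 1

count<count : ∀ n P y → y < n → P y ≡ true → count y P < count n P
count<count n P y y<n Py = subst (_≤ count n P) (count-suc-true y P Py) (count-mono P y<n)

count-stable : ∀ {k} n p → k ≤ n → (∀ x → k ≤ x → x < n → p x ≡ false) → count n p ≡ count k p
count-stable zero    p z≤n h = refl
count-stable (suc n) p k≤1+n h with m≤n⇒m<n∨m≡n k≤1+n
... | inj₂ refl = refl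
... | inj₁ (s≤s k≤n) rewrite h n k≤n ≤-refl =
  trans (+-identityʳ _) (count-stable n p k≤n (λ x k≤x x<n → h x k≤x (m≤n⇒m≤1+n x<n)))

count-growth : ∀ {k} n p → k ≤ n → count n p + k ≤ count k p + n
count-growth zero    p z≤n = ≤-refl
count-growth {k} (suc n) p k≤1+n with m≤n⇒m<n∨m≡n k≤1+n
... | inj₂ refl = ≤-refl
... | inj₁ (s≤s k≤n) = begin
    count n p + χ (p n) + k ≡⟨ xy∙z≈xz∙y (count n p) (χ (p n)) k ⟩
    count n p + k + χ (p n) ≤⟨ +-mono-≤ (count-growth n p k≤n) (χ≤1 (p n)) ⟩
    count k p + n + 1       ≡⟨ +-assoc (count k p) n 1 ⟩
    count k p + (n + 1)     ≡⟨ cong (count k p +_) (+-comm n 1) ⟩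
    count k p + suc n       ∎
  where open ≤-Reasoning

count-restrict : ∀ {n} W p → n ≤ W → count W (λ x → (x <ᵇ n) ∧ p x) ≡ count n p
count-restrict {n} W p n≤W = trans
  (count-stable W _ n≤W (λ x n≤x _ → cong (_∧ p x) (≮⇒<ᵇ≡false (≤⇒≯ n≤x))))
  (count-cong n (λ x x<n → cong (_∧ p x) (<⇒<ᵇ≡true x<n)))

count≤1 : ∀ n p → (∀ x y → x < n → y < n → p x ≡ true → p y ≡ true → x ≡ y) → count n p ≤ 1
count≤1 zero    p h = z≤n
count≤1 (suc n) p h with p n in pn
... | true rewrite count-none n {p} (λ x x<n → ¬-not (λ px → <⇒≢ x<n (h x n (m≤n⇒m≤1+n x<n) ≤-refl px pn))) = ≤-refl
... | false = subst (_≤ 1) (sym (+-identityʳ _))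
  (count≤1 n p (λ x y x<n y<n → h x y (m≤n⇒m≤1+n x<n) (m≤n⇒m≤1+n y<n)))

count-from : ∀ lo h → lo ≤ h → count h (lo ≤ᵇ_) + lo ≡ h
count-from lo zero    z≤n = refl
count-from lo (suc h) lo≤1+h with m≤n⇒m<n∨m≡n lo≤1+h
... | inj₂ refl = cong (_+ suc h) (count-none (suc h) (λ x x<1+h → ≰⇒≤ᵇ≡false (<⇒≱ x<1+h)))
... | inj₁ (s≤s lo≤h) rewrite ≤⇒≤ᵇ≡true lo≤h = begin
    count h (lo ≤ᵇ_) + 1 + lo ≡⟨ +-assoc (count h _) 1 lo ⟩
    count h (lo ≤ᵇ_) + suc lo ≡⟨ +-suc (count h _) lo ⟩
    suc (count h (lo ≤ᵇ_) + lo) ≡⟨ cong suc (count-from lo h lo≤h) ⟩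
    suc h ∎
  where open ≡-Reasoning

count-interval : ∀ n lo h → lo ≤ h → h ≤ n → count n (λ x → (lo ≤ᵇ x) ∧ (x <ᵇ h)) + lo ≡ h
count-interval n lo h lo≤h h≤n = begin
    count n (λ x → (lo ≤ᵇ x) ∧ (x <ᵇ h)) + lo ≡⟨ cong (_+ lo) (count-cong n (λ x _ → ∧-comm (lo ≤ᵇ x) (x <ᵇ h))) ⟩
    count n (λ x → (x <ᵇ h) ∧ (lo ≤ᵇ x)) + lo ≡⟨ cong (_+ lo) (count-restrict n (lo ≤ᵇ_) h≤n) ⟩
    count h (lo ≤ᵇ_) + lo                    ≡⟨ count-from lo h lo≤h ⟩
    h                                        ∎
  where open ≡-Reasoning

count-interval≤ : ∀ n lo h → lo ≤ h → count n (λ r → (lo ≤ᵇ r) ∧ (r <ᵇ h)) + lo ≤ h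
count-interval≤ n lo h lo≤h = ≤-trans (+-monoˡ-≤ lo (count-mono _ (m≤m+n n h)))
  (≤-reflexive (count-interval (n + h) lo h lo≤h (m≤n+m h n)))

count-below : ∀ W A → A ≤ W → count W (_<ᵇ A) ≡ A
count-below W A A≤W = trans (sym (+-identityʳ _)) (count-interval W 0 A z≤n A≤W)

sumTo-+ : ∀ n f g → sumTo n (λ x → f x + g x) ≡ sumTo n f + sumTo n g
sumTo-+ zero    f g = refl
sumTo-+ (suc n) f g = trans (cong (_+ (f n + g n)) (sumTo-+ n f g)) (interchange (sumTo n f) (sumTo n g) (f n) (g n))

sumTo-swap : ∀ R W (h : ℕ → ℕ → ℕ) → sumTo R (λ r → sumTo W (h r)) ≡ sumTo W (λ c → sumTo R (λ r → h r c))
sumTo-swap zero    W h = sym (sumTo-zero W)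
  where
  sumTo-zero : ∀ W → sumTo W (λ _ → 0) ≡ 0
  sumTo-zero zero    = refl
  sumTo-zero (suc W) = cong (_+ 0) (sumTo-zero W)
sumTo-swap (suc R) W h = trans (cong (_+ sumTo W (h R)) (sumTo-swap R W h)) (sym (sumTo-+ W _ (h R)))

sumTo-cong : ∀ n {f g} → (∀ x → x < n → f x ≡ g x) → sumTo n f ≡ sumTo n g
sumTo-cong zero    h = refl
sumTo-cong (suc n) h = cong₂ _+_ (sumTo-cong n (∀<-weaken h)) (h n ≤-refl)

sumTo-mono : ∀ n {f g} → (∀ x → x < n → f x ≤ g x) → sumTo n f ≤ sumTo n g
sumTo-mono zero    h = z≤n
sumTo-mono (suc n) h = +-mono-≤ (sumTo-mono n (∀<-weaken h)) (h n ≤-refl)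

count≡sumTo : ∀ n p → count n p ≡ sumTo n (χ ∘ p)
count≡sumTo zero    p = refl
count≡sumTo (suc n) p = cong (_+ χ (p n)) (count≡sumTo n p)

count-∪ : ∀ n p q s → (∀ x → x < n → p x ≡ true → q x ≡ true ⊎ s x ≡ true) → count n p ≤ count n q + count n s
count-∪ n p q s h = begin
    count n p                             ≡⟨ count≡sumTo n p ⟩
    sumTo n (χ ∘ p)                       ≤⟨ sumTo-mono n (λ x x<n → χ-∪ (p x) (h x x<n)) ⟩
    sumTo n (λ x → χ (q x) + χ (s x))     ≡⟨ sumTo-+ n (χ ∘ q) (χ ∘ s) ⟩
    sumTo n (χ ∘ q) + sumTo n (χ ∘ s)     ≡⟨ sym (cong₂ _+_ (count≡sumTo n q) (count≡sumTo n s)) ⟩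
    count n q + count n s                 ∎
  where
  open ≤-Reasoning
  χ-∪ : ∀ {b c} a → (a ≡ true → b ≡ true ⊎ c ≡ true) → χ a ≤ χ b + χ c
  χ-∪ false _ = z≤n
  χ-∪ true  h with h refl
  ... | inj₁ refl = s≤s z≤n
  ... | inj₂ refl = m≤n+m 1 _

-- nth n P j is the j-th element (from 0) of {y < n | P y}: the number of x < n
-- with at most j elements of the set in [0, x].
nth : ℕ → (ℕ → Bool) → ℕ → ℕ
nth n P j = count n (λ x → count (suc x) P ≤ᵇ j)

nth-unique : ∀ n P y j → y < n → P y ≡ true → count y P ≡ j → nth n P j ≡ y
nth-unique n P y j y<n Py cy≡j = trans (count-cong n below) (trans (sym (+-identityʳ _)) (count-interval n 0 y z≤n (<⇒≤ y<n)))
  where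
  j<count : j < count (suc y) P
  j<count = subst (j <_) (sym (count-suc-true y P Py)) (s≤s (≤-reflexive (sym cy≡j)))
  below : ∀ x → x < n → (count (suc x) P ≤ᵇ j) ≡ (x <ᵇ y)
  below x _ with x <? y
  ... | yes x<y = trans (≤⇒≤ᵇ≡true (subst (count (suc x) P ≤_) cy≡j (count-mono P x<y))) (sym (<⇒<ᵇ≡true x<y))
  ... | no x≮y  = trans (≰⇒≤ᵇ≡false (<⇒≱ (<-≤-trans j<count (count-mono P (s≤s (≮⇒≥ x≮y))))))
                        (sym (≮⇒<ᵇ≡false x≮y))

nth-exists : ∀ n P j → j < count n P → ∃ λ y → y < n × P y ≡ true × count y P ≡ j
nth-exists (suc n) P j j<count with j <? count n P
... | yes j<count' with nth-exists n P j j<count'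
...   | y , y<n , Py , cy = y , m≤n⇒m≤1+n y<n , Py , cy
nth-exists (suc n) P j j<count | no j≮count with P n in Pn
... | true  = n , ≤-refl , Pn , ≤-antisym (≮⇒≥ j≮count) (s≤s⁻¹ (subst (j <_) (+-comm (count n P) 1) j<count))
... | false = ⊥-elim (j≮count (subst (j <_) (+-identityʳ _) j<count))

module Nth (n : ℕ) (P : ℕ → Bool) {j : ℕ} (j<count : j < count n P) where
  private
    y = proj₁ (nth-exists n P j j<count)
    y<n = proj₁ (proj₂ (nth-exists n P j j<count))
    Py = proj₁ (proj₂ (proj₂ (nth-exists n P j j<count)))
    cy = proj₂ (proj₂ (proj₂ (nth-exists n P j j<count)))
    nth≡y : nth n P j ≡ y
    nth≡y = nth-unique n P y j y<n Py cy

  nth< : nth n P j < n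
  nth< = subst (_< n) (sym nth≡y) y<n

  nth-true : P (nth n P j) ≡ true
  nth-true = subst (λ z → P z ≡ true) (sym nth≡y) Py

  count-nth : count (nth n P j) P ≡ j
  count-nth = subst (λ z → count z P ≡ j) (sym nth≡y) cy

  count-suc-nth : count (suc (nth n P j)) P ≡ suc j
  count-suc-nth = trans (count-suc-true _ P nth-true) (cong suc count-nth)

  count≤index : ∀ {y} → y ≤ nth n P j → count y P ≤ j
  count≤index {y} y≤nth = subst (count y P ≤_) count-nth (count-mono P y≤nth)

nth-strict : ∀ n P j j' → j < j' → j' < count n P → nth n P j < nth n P j'
nth-strict n P j j' j<j' j'<count with nth n P j' ≤? nth n P j
... | no nth'≰nth  = ≰⇒> nth'≰nth
... | yes nth'≤nth = contradiction
  (subst₂ _≤_ (Nth.count-nth n P j'<count) (Nth.count-nth n P (<-trans j<j' j'<count)) (count-mono P nth'≤nth))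
  (<⇒≱ j<j')

nth-cong : ∀ n {P Q} j → (∀ y → P y ≡ Q y) → nth n P j ≡ nth n Q j
nth-cong n j P≡Q = count-cong n (λ x _ → cong (_≤ᵇ j) (count-cong (suc x) (λ y _ → P≡Q y)))

image : ℕ → ℕ → (ℕ → ℕ) → ℕ → Bool
image lo hi f y = 1 ≤ᵇ count hi (λ r → (lo ≤ᵇ r) ∧ (f r ≡ᵇ y))

countBelow : ℕ → ℕ → (ℕ → ℕ) → ℕ → ℕ
countBelow lo hi f x = count hi (λ r → (lo ≤ᵇ r) ∧ (f r <ᵇ x))

image⇒∃ : ∀ lo hi f y → image lo hi f y ≡ true → ∃ λ r → lo ≤ r × r < hi × f r ≡ y
image⇒∃ lo hi f y img with count-pos⇒∃ hi _ (≤ᵇ≡true⇒≤ img)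
... | r , r<hi , hit = r , ≤ᵇ≡true⇒≤ (∧-trueˡ hit) , r<hi , ≡ᵇ≡true⇒≡ (∧-trueʳ {lo ≤ᵇ r} hit)

∃⇒image : ∀ lo hi f y r → lo ≤ r → r < hi → f r ≡ y → image lo hi f y ≡ true
∃⇒image lo hi f y r lo≤r r<hi fr≡y = ≤⇒≤ᵇ≡true (∃⇒count-pos hi _ r r<hi (∧-true (≤⇒≤ᵇ≡true lo≤r) (≡⇒≡ᵇ≡true fr≡y)))

image-cong : ∀ lo hi {f g} → (∀ r → lo ≤ r → r < hi → f r ≡ g r) → ∀ y → image lo hi f y ≡ image lo hi g y
image-cong lo hi {f} {g} f≡g y = cong (1 ≤ᵇ_) (count-cong hi pointwise)
  where
  pointwise : ∀ r → r < hi → ((lo ≤ᵇ r) ∧ (f r ≡ᵇ y)) ≡ ((lo ≤ᵇ r) ∧ (g r ≡ᵇ y))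
  pointwise r r<hi = ∧-cong-if (lo ≤ᵇ r) λ lo≤ᵇr → cong (_≡ᵇ y) (f≡g r (≤ᵇ≡true⇒≤ lo≤ᵇr) r<hi)

image-bounded : ∀ lo hi f k → (∀ r → lo ≤ r → r < hi → f r < k) → ∀ y → image lo hi f y ≡ true → y < k
image-bounded lo hi f k bound y img with image⇒∃ lo hi f y img
... | r , lo≤r , r<hi , refl = bound r lo≤r r<hi

InjectiveOn : ℕ → ℕ → (ℕ → ℕ) → Set
InjectiveOn lo hi f = ∀ r r' → lo ≤ r → r < hi → lo ≤ r' → r' < hi → f r ≡ f r' → r ≡ r'

χ-<-suc : ∀ b v x → χ (b ∧ (v <ᵇ x)) + χ (b ∧ (v ≡ᵇ x)) ≡ χ (b ∧ (v <ᵇ suc x))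
χ-<-suc false v x = refl
χ-<-suc true  v x with <-cmp v x
... | tri< v<x v≢x _ rewrite <⇒<ᵇ≡true v<x | ≢⇒≡ᵇ≡false v≢x | <⇒<ᵇ≡true (m≤n⇒m≤1+n v<x) = refl
... | tri≈ v≮x refl _ rewrite ≮⇒<ᵇ≡false v≮x | ≡⇒≡ᵇ≡true {v} refl | <⇒<ᵇ≡true (n<1+n v) = refl
... | tri> _ v≢x x<v rewrite ≮⇒<ᵇ≡false (<⇒≯ x<v) | ≢⇒≡ᵇ≡false v≢x | ≮⇒<ᵇ≡false (≤⇒≯ x<v) = refl

count-image : ∀ lo hi f → InjectiveOn lo hi f → ∀ x → count x (image lo hi f) ≡ countBelow lo hi f x
count-image lo hi f inj zero = sym (count-none hi (λ r _ → ∧-zeroʳ (lo ≤ᵇ r)))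
count-image lo hi f inj (suc x) = begin
    count x (image lo hi f) + χ (image lo hi f x)
  ≡⟨ cong₂ _+_ (count-image lo hi f inj x) (sym (≤1⇒≡χ _ (count≤1 hi _ hits-unique))) ⟩
    countBelow lo hi f x + count hi (λ r → (lo ≤ᵇ r) ∧ (f r ≡ᵇ x))
  ≡⟨ count-+ hi (λ r _ → χ-<-suc (lo ≤ᵇ r) (f r) x) ⟩
    countBelow lo hi f (suc x) ∎
  where
  open ≡-Reasoning
  hits-unique : ∀ r r' → r < hi → r' < hi → ((lo ≤ᵇ r) ∧ (f r ≡ᵇ x)) ≡ true → ((lo ≤ᵇ r') ∧ (f r' ≡ᵇ x)) ≡ true → r ≡ r'
  hits-unique r r' r<hi r'<hi hit hit' = inj r r' (≤ᵇ≡true⇒≤ (∧-trueˡ hit)) r<hi (≤ᵇ≡true⇒≤ (∧-trueˡ hit')) r'<hi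
    (trans (≡ᵇ≡true⇒≡ (∧-trueʳ {lo ≤ᵇ r} hit)) (sym (≡ᵇ≡true⇒≡ (∧-trueʳ {lo ≤ᵇ r'} hit'))))

count-image-size : ∀ lo hi f k → lo ≤ hi → InjectiveOn lo hi f → (∀ r → lo ≤ r → r < hi → f r < k) →
                   count k (image lo hi f) + lo ≡ hi
count-image-size lo hi f k lo≤hi inj bound =
  trans (cong (_+ lo) (trans (count-image lo hi f inj k) (count-cong hi pointwise))) (count-interval hi lo hi lo≤hi ≤-refl)
  where
  pointwise : ∀ r → r < hi → ((lo ≤ᵇ r) ∧ (f r <ᵇ k)) ≡ ((lo ≤ᵇ r) ∧ (r <ᵇ hi))
  pointwise r r<hi = ∧-cong-if (lo ≤ᵇ r) λ lo≤ᵇr →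
    trans (<⇒<ᵇ≡true (bound r (≤ᵇ≡true⇒≤ lo≤ᵇr) r<hi)) (sym (<⇒<ᵇ≡true r<hi))

IncreasingOn DecreasingOn : ℕ → ℕ → (ℕ → ℕ) → Set
IncreasingOn lo hi f = ∀ r → lo ≤ r → suc r < hi → f r < f (suc r)
DecreasingOn lo hi f = ∀ r → lo ≤ r → suc r < hi → f (suc r) < f r

increasing-< : ∀ {lo hi f} → IncreasingOn lo hi f → ∀ r r' → lo ≤ r → r < r' → r' < hi → f r < f r'
increasing-< inc r (suc r') lo≤r r<1+r' 1+r'<hi with m<1+n⇒m<n∨m≡n r<1+r'
... | inj₂ refl = inc r lo≤r 1+r'<hi
... | inj₁ r<r' = <-trans (increasing-< inc r r' lo≤r r<r' (<-trans (n<1+n r') 1+r'<hi))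
                          (inc r' (≤-trans lo≤r (<⇒≤ r<r')) 1+r'<hi)

decreasing-< : ∀ {lo hi f} → DecreasingOn lo hi f → ∀ r r' → lo ≤ r → r < r' → r' < hi → f r' < f r
decreasing-< dec r (suc r') lo≤r r<1+r' 1+r'<hi with m<1+n⇒m<n∨m≡n r<1+r'
... | inj₂ refl = dec r lo≤r 1+r'<hi
... | inj₁ r<r' = <-trans (dec r' (≤-trans lo≤r (<⇒≤ r<r')) 1+r'<hi)
                          (decreasing-< dec r r' lo≤r r<r' (<-trans (n<1+n r') 1+r'<hi))

increasing⇒injective : ∀ {lo hi f} → IncreasingOn lo hi f → InjectiveOn lo hi f
increasing⇒injective inc r r' lo≤r r<hi lo≤r' r'<hi fr≡fr' with <-cmp r r'
... | tri< r<r' _ _ = contradiction fr≡fr' (<⇒≢ (increasing-< inc r r' lo≤r r<r' r'<hi))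
... | tri≈ _ r≡r' _ = r≡r'
... | tri> _ _ r'<r = contradiction (sym fr≡fr') (<⇒≢ (increasing-< inc r' r lo≤r' r'<r r<hi))

decreasing⇒injective : ∀ {lo hi f} → DecreasingOn lo hi f → InjectiveOn lo hi f
decreasing⇒injective dec r r' lo≤r r<hi lo≤r' r'<hi fr≡fr' with <-cmp r r'
... | tri< r<r' _ _ = contradiction (sym fr≡fr') (<⇒≢ (decreasing-< dec r r' lo≤r r<r' r'<hi))
... | tri≈ _ r≡r' _ = r≡r'
... | tri> _ _ r'<r = contradiction fr≡fr' (<⇒≢ (decreasing-< dec r' r lo≤r' r'<r r<hi))

increasing-reflects-< : ∀ {lo hi f} → IncreasingOn lo hi f →
                        ∀ {r r'} → lo ≤ r → r < hi → lo ≤ r' → r' < hi → f r < f r' → r < r'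
increasing-reflects-< inc {r} {r'} lo≤r r<hi lo≤r' r'<hi fr<fr' with <-cmp r r'
... | tri< r<r' _ _ = r<r'
... | tri≈ _ refl _ = contradiction fr<fr' (<-irrefl refl)
... | tri> _ _ r'<r = contradiction fr<fr' (<⇒≯ (increasing-< inc r' r lo≤r' r'<r r<hi))

decreasing-reflects-< : ∀ {lo hi f} → DecreasingOn lo hi f →
                        ∀ {r r'} → lo ≤ r → r < hi → lo ≤ r' → r' < hi → f r < f r' → r' < r
decreasing-reflects-< dec {r} {r'} lo≤r r<hi lo≤r' r'<hi fr<fr' with <-cmp r' r
... | tri< r'<r _ _ = r'<r
... | tri≈ _ refl _ = contradiction fr<fr' (<-irrefl refl)
... | tri> _ _ r<r' = contradiction fr<fr' (<⇒≯ (decreasing-< dec r r' lo≤r r<r' r'<hi))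

countBelow-increasing : ∀ {lo hi f} → IncreasingOn lo hi f → ∀ r → lo ≤ r → r < hi → countBelow lo hi f (f r) + lo ≡ r
countBelow-increasing {lo} {hi} {f} inc r lo≤r r<hi =
  trans (cong (_+ lo) (count-cong hi pointwise)) (count-interval hi lo r lo≤r (<⇒≤ r<hi))
  where
  pointwise : ∀ r' → r' < hi → ((lo ≤ᵇ r') ∧ (f r' <ᵇ f r)) ≡ ((lo ≤ᵇ r') ∧ (r' <ᵇ r))
  pointwise r' r'<hi = ∧-cong-if (lo ≤ᵇ r') λ lo≤ᵇr' → let lo≤r' = ≤ᵇ≡true⇒≤ lo≤ᵇr' in bool-ext
    (<⇒<ᵇ≡true ∘ increasing-reflects-< inc lo≤r' r'<hi lo≤r r<hi ∘ <ᵇ≡true⇒<)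
    (λ r'<ᵇr → <⇒<ᵇ≡true (increasing-< inc r' r lo≤r' (<ᵇ≡true⇒< r'<ᵇr) r<hi))

countBelow-decreasing : ∀ {lo hi f} → DecreasingOn lo hi f → ∀ r → lo ≤ r → r < hi → countBelow lo hi f (f r) + suc r ≡ hi
countBelow-decreasing {lo} {hi} {f} dec r lo≤r r<hi =
  trans (cong (_+ suc r) (count-cong hi pointwise)) (count-interval hi (suc r) hi r<hi ≤-refl)
  where
  pointwise : ∀ r' → r' < hi → ((lo ≤ᵇ r') ∧ (f r' <ᵇ f r)) ≡ ((suc r ≤ᵇ r') ∧ (r' <ᵇ hi))
  pointwise r' r'<hi = bool-ext
    (λ below → let lo≤r' = ≤ᵇ≡true⇒≤ (∧-trueˡ below) in
      ∧-true (≤⇒≤ᵇ≡true (decreasing-reflects-< dec lo≤r' r'<hi lo≤r r<hi (<ᵇ≡true⇒< (∧-trueʳ {lo ≤ᵇ r'} below))))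
             (<⇒<ᵇ≡true r'<hi))
    (λ after → let r<r' = ≤ᵇ≡true⇒≤ (∧-trueˡ after) in
      ∧-true (≤⇒≤ᵇ≡true (≤-trans lo≤r (<⇒≤ r<r'))) (<⇒<ᵇ≡true (decreasing-< dec r r' lo≤r r<r' r'<hi)))

index<-increasing : ∀ {lo hi r c} → lo ≤ r → r < hi → c + lo ≡ hi → r ∸ lo < c
index<-increasing {lo} lo≤r r<hi c+lo≡hi = +-cancelʳ-< lo _ _ (subst₂ _<_ (sym (m∸n+n≡m lo≤r)) (sym c+lo≡hi) r<hi)

index<-decreasing : ∀ {lo hi r c} → lo ≤ r → r < hi → c + lo ≡ hi → hi ∸ suc r < c
index<-decreasing {lo} {hi} {r} lo≤r r<hi c+lo≡hi =
  +-cancelʳ-< lo _ _ (subst (hi ∸ suc r + lo <_) (trans (m∸n+n≡m r<hi) (sym c+lo≡hi)) (+-monoʳ-< (hi ∸ suc r) (s≤s lo≤r)))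

nth-increasing : ∀ n P lo hi → count n P + lo ≡ hi → IncreasingOn lo hi (λ r → nth n P (r ∸ lo))
nth-increasing n P lo hi total r lo≤r 1+r<hi =
  nth-strict n P _ _ (∸-monoˡ-< ≤-refl lo≤r) (index<-increasing (≤-trans lo≤r (n≤1+n r)) 1+r<hi total)

nth-decreasing : ∀ n P lo hi → count n P + lo ≡ hi → DecreasingOn lo hi (λ r → nth n P (hi ∸ suc r))
nth-decreasing n P lo hi total r lo≤r 1+r<hi =
  nth-strict n P _ _ (∸-monoʳ-< {hi} ≤-refl 1+r<hi) (index<-decreasing lo≤r (<-trans ≤-refl 1+r<hi) total)

nth-image-increasing : ∀ n P lo hi → (∀ y → P y ≡ true → y < n) → count n P + lo ≡ hi →
                       ∀ y → image lo hi (λ r → nth n P (r ∸ lo)) y ≡ P y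
nth-image-increasing n P lo hi bound total y = bool-ext to from
  where
  to : image lo hi (λ r → nth n P (r ∸ lo)) y ≡ true → P y ≡ true
  to img with image⇒∃ lo hi (λ r → nth n P (r ∸ lo)) y img
  ... | r , lo≤r , r<hi , fr≡y = subst (λ z → P z ≡ true) fr≡y (Nth.nth-true n P (index<-increasing lo≤r r<hi total))
  from : P y ≡ true → image lo hi (λ r → nth n P (r ∸ lo)) y ≡ true
  from Py = ∃⇒image lo hi (λ r → nth n P (r ∸ lo)) y (count y P + lo) (m≤n+m lo _)
    (subst (count y P + lo <_) total (+-monoˡ-< lo (count<count n P y (bound y Py) Py)))
    (trans (cong (nth n P) (m+n∸n≡m (count y P) lo)) (nth-unique n P y _ (bound y Py) Py refl))

nth-image-decreasing : ∀ n P lo hi → (∀ y → P y ≡ true → y < n) → count n P + lo ≡ hi →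
                       ∀ y → image lo hi (λ r → nth n P (hi ∸ suc r)) y ≡ P y
nth-image-decreasing n P lo hi bound total y = bool-ext to from
  where
  to : image lo hi (λ r → nth n P (hi ∸ suc r)) y ≡ true → P y ≡ true
  to img with image⇒∃ lo hi (λ r → nth n P (hi ∸ suc r)) y img
  ... | r , lo≤r , r<hi , fr≡y = subst (λ z → P z ≡ true) fr≡y (Nth.nth-true n P (index<-decreasing lo≤r r<hi total))
  from : P y ≡ true → image lo hi (λ r → nth n P (hi ∸ suc r)) y ≡ true
  from Py = ∃⇒image lo hi (λ r → nth n P (hi ∸ suc r)) y (hi ∸ suc j) lo≤r (∸-monoʳ-< {hi} {suc j} {0} (s≤s z≤n) j<hi) row-index
    where
    j = count y P
    lo+1+j≤hi : lo + suc j ≤ hi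
    lo+1+j≤hi = subst₂ _≤_ (+-comm (suc j) lo) total (+-monoˡ-≤ lo (count<count n P y (bound y Py) Py))
    j<hi : j < hi
    j<hi = m+n≤o⇒n≤o lo lo+1+j≤hi
    lo≤r : lo ≤ hi ∸ suc j
    lo≤r = m+n≤o⇒m≤o∸n lo lo+1+j≤hi
    row-index : nth n P (hi ∸ suc (hi ∸ suc j)) ≡ y
    row-index = trans (cong (nth n P) (trans (cong (hi ∸_) (sym (+-∸-assoc 1 j<hi))) (m∸[m∸n]≡n (<⇒≤ j<hi))))
                      (nth-unique n P y j (bound y Py) Py refl)

increasing≡nth : ∀ n {lo hi f} → IncreasingOn lo hi f → (∀ r → lo ≤ r → r < hi → f r < n) →
                 ∀ r → lo ≤ r → r < hi → f r ≡ nth n (image lo hi f) (r ∸ lo)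
increasing≡nth n {lo} {hi} {f} inc bound r lo≤r r<hi = sym (nth-unique n (image lo hi f) (f r) (r ∸ lo) (bound r lo≤r r<hi)
  (∃⇒image lo hi f (f r) r lo≤r r<hi refl)
  (trans (count-image lo hi f (increasing⇒injective inc) (f r))
         (trans (sym (m+n∸n≡m _ lo)) (cong (_∸ lo) (countBelow-increasing inc r lo≤r r<hi)))))

decreasing≡nth : ∀ n {lo hi f} → DecreasingOn lo hi f → (∀ r → lo ≤ r → r < hi → f r < n) →
                 ∀ r → lo ≤ r → r < hi → f r ≡ nth n (image lo hi f) (hi ∸ suc r)
decreasing≡nth n {lo} {hi} {f} dec bound r lo≤r r<hi = sym (nth-unique n (image lo hi f) (f r) (hi ∸ suc r) (bound r lo≤r r<hi)
  (∃⇒image lo hi f (f r) r lo≤r r<hi refl)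
  (trans (count-image lo hi f (decreasing⇒injective dec) (f r))
         (trans (sym (m+n∸n≡m _ (suc r))) (cong (_∸ suc r) (countBelow-decreasing dec r lo≤r r<hi)))))

-- Column lengths of a partition

colLength : List ℕ → ℕ → ℕ
colLength []       c = 0
colLength (x ∷ xs) c = χ (c <ᵇ x) + colLength xs c

Descending : List ℕ → Set
Descending = Linked _≥_

part≤head : ∀ {x xs} → Descending (x ∷ xs) → ∀ r → part (x ∷ xs) r ≤ x
part≤head d                   zero    = ≤-refl
part≤head {xs = []}     d     (suc r) = z≤n
part≤head {xs = y ∷ ys} (y≤x ∷ d) (suc r) = ≤-trans (part≤head d r) y≤x

part≤part0 : ∀ {ρ} → Descending ρ → ∀ r → part ρ r ≤ part ρ 0
part≤part0 {[]}    d r = z≤n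
part≤part0 {_ ∷ _} d r = part≤head d r

colLength-head≤ : ∀ {x xs} c → Descending (x ∷ xs) → x ≤ c → colLength (x ∷ xs) c ≡ 0
colLength-head≤ {xs = []}     c d       x≤c rewrite ≮⇒<ᵇ≡false (≤⇒≯ x≤c) = refl
colLength-head≤ {xs = y ∷ ys} c (y≤x ∷ d) x≤c rewrite ≮⇒<ᵇ≡false (≤⇒≯ x≤c) = colLength-head≤ c d (≤-trans y≤x x≤c)

<part⇒<colLength : ∀ {ρ} → Descending ρ → ∀ c r → c < part ρ r → r < colLength ρ c
<part⇒<colLength {x ∷ xs} d c zero    c<x rewrite <⇒<ᵇ≡true c<x = s≤s z≤n
<part⇒<colLength {x ∷ xs} d c (suc r) c<part rewrite <⇒<ᵇ≡true (<-≤-trans c<part (part≤head d (suc r))) =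
  s≤s (<part⇒<colLength (Linked.tail d) c r c<part)

<colLength⇒<part : ∀ {ρ} → Descending ρ → ∀ c r → r < colLength ρ c → c < part ρ r
<colLength⇒<part {x ∷ xs} d c r r<len with c <? x
... | no c≮x rewrite colLength-head≤ c d (≮⇒≥ c≮x) = contradiction r<len λ ()
<colLength⇒<part {x ∷ xs} d c zero    r<len | yes c<x = c<x
<colLength⇒<part {x ∷ xs} d c (suc r) r<len | yes c<x rewrite <⇒<ᵇ≡true c<x =
  <colLength⇒<part (Linked.tail d) c r (s≤s⁻¹ r<len)

part≤⇒colLength≤ : ∀ {ρ} → Descending ρ → ∀ c r → part ρ r ≤ c → colLength ρ c ≤ r
part≤⇒colLength≤ d c r part≤c = ≮⇒≥ (λ r<len → <⇒≱ (<colLength⇒<part d c r r<len) part≤c)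

colLength≤⇒part≤ : ∀ {ρ} → Descending ρ → ∀ c r → colLength ρ c ≤ r → part ρ r ≤ c
colLength≤⇒part≤ d c r len≤r = ≮⇒≥ (λ c<part → <⇒≱ (<part⇒<colLength d c r c<part) len≤r)

colLength≤length : ∀ ρ c → colLength ρ c ≤ length ρ
colLength≤length []       c = z≤n
colLength≤length (x ∷ xs) c = +-mono-≤ (χ≤1 (c <ᵇ x)) (colLength≤length xs c)

colLength-suc : ∀ ρ c → colLength ρ (suc c) ≤ colLength ρ c
colLength-suc []       c = z≤n
colLength-suc (x ∷ xs) c =
  +-mono-≤ (χ-mono {suc c <ᵇ x} (λ 1+c<x → <⇒<ᵇ≡true (<-trans (n<1+n c) (<ᵇ≡true⇒< {suc c} {x} 1+c<x)))) (colLength-suc xs c)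

colLength-++ : ∀ xs ys c → colLength (xs ++ ys) c ≡ colLength xs c + colLength ys c
colLength-++ []       ys c = refl
colLength-++ (x ∷ xs) ys c = trans (cong (χ (c <ᵇ x) +_) (colLength-++ xs ys c)) (sym (+-assoc (χ (c <ᵇ x)) _ _))

colLength-insertDesc : ∀ x ys c → colLength (insertDesc x ys) c ≡ χ (c <ᵇ x) + colLength ys c
colLength-insertDesc x []       c = refl
colLength-insertDesc x (y ∷ ys) c with y ≤ᵇ x
... | true  = refl
... | false = trans (cong (χ (c <ᵇ y) +_) (colLength-insertDesc x ys c)) (x∙yz≈y∙xz (χ (c <ᵇ y)) (χ (c <ᵇ x)) (colLength ys c))

colLength-sortDesc : ∀ xs c → colLength (sortDesc xs) c ≡ colLength xs c
colLength-sortDesc []       c = refl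
colLength-sortDesc (x ∷ xs) c = trans (colLength-insertDesc x (sortDesc xs) c) (cong (χ (c <ᵇ x) +_) (colLength-sortDesc xs c))

insertDesc-below : ∀ z x ys → x ≤ z → Descending (z ∷ ys) → Descending (z ∷ insertDesc x ys)
insertDesc-below z x []       x≤z d = x≤z ∷ [-]
insertDesc-below z x (y ∷ ys) x≤z (y≤z ∷ d) with y ≤? x
... | yes y≤x rewrite ≤⇒≤ᵇ≡true y≤x = x≤z ∷ (y≤x ∷ d)
... | no y≰x  rewrite ≰⇒≤ᵇ≡false y≰x = y≤z ∷ insertDesc-below y x ys (<⇒≤ (≰⇒> y≰x)) d

insertDesc-descending : ∀ x ys → Descending ys → Descending (insertDesc x ys)
insertDesc-descending x []       d = [-]
insertDesc-descending x (y ∷ ys) d with y ≤? x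
... | yes y≤x rewrite ≤⇒≤ᵇ≡true y≤x = y≤x ∷ d
... | no y≰x  rewrite ≰⇒≤ᵇ≡false y≰x = insertDesc-below y x ys (<⇒≤ (≰⇒> y≰x)) d

sortDesc-descending : ∀ xs → Descending (sortDesc xs)
sortDesc-descending []       = []
sortDesc-descending (x ∷ xs) = insertDesc-descending x (sortDesc xs) (sortDesc-descending xs)

dominant⇒descending : ∀ {n} (a : Vec ℕ n) → Dominant a → Descending (Vec.toList a)
dominant⇒descending Vec.[]                       dom = []
dominant⇒descending (x Vec.∷ Vec.[])             dom = [-]
dominant⇒descending (x Vec.∷ y Vec.∷ a) dom =
  dom Fin.zero (Fin.suc Fin.zero) z≤n ∷ dominant⇒descending (y Vec.∷ a) (λ i j i≤j → dom (Fin.suc i) (Fin.suc j) (s≤s i≤j))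

part-toList : ∀ {n} (a : Vec ℕ n) i → part (Vec.toList a) (toℕ i) ≡ Vec.lookup a i
part-toList (x Vec.∷ a) Fin.zero    = refl
part-toList (x Vec.∷ a) (Fin.suc i) = part-toList a i

colLength-mono : ∀ {ρ ν} → Descending ρ → Descending ν →
                 (∀ r → part ρ r ≤ part ν r) → ∀ c → colLength ρ c ≤ colLength ν c
colLength-mono {ρ} {ν} dρ dν ρ⊆ν c = ≮⇒≥ λ lenν<lenρ →
  <-irrefl refl (<part⇒<colLength dν c _ (<-≤-trans (<colLength⇒<part dρ c _ lenν<lenρ) (ρ⊆ν _)))

colLength-mono⇒part≤ : ∀ {ρ ν} → Descending ρ → Descending ν →
                       (∀ c → colLength ρ c ≤ colLength ν c) → ∀ r → part ρ r ≤ part ν r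
colLength-mono⇒part≤ {ρ} {ν} dρ dν ρ⊆ν r = ≮⇒≥ λ partν<partρ →
  <-irrefl refl (<colLength⇒<part dν (part ν r) r (<-≤-trans (<part⇒<colLength dρ (part ν r) r partν<partρ) (ρ⊆ν _)))

column : ∀ {m} → Filling m → ℕ → ℕ → ℕ
column F c r = toℕ (F r c)

-- Column c of a filling of ν/ρ occupies the rows colLength ρ c ≤ r < colLength ν c.
columnSet : ∀ {m} → List ℕ → List ℕ → Filling m → ℕ → ℕ → Bool
columnSet ν ρ F c = image (colLength ρ c) (colLength ν c) (column F c)

⌊≟⌋≡≡ᵇ : ∀ {m} (x i : Fin m) → ⌊ x ≟ i ⌋ ≡ (toℕ x ≡ᵇ toℕ i)
⌊≟⌋≡≡ᵇ x i with x ≟ i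
... | yes refl = sym (≡⇒≡ᵇ≡true {toℕ x} refl)
... | no x≢i   = sym (≢⇒≡ᵇ≡false (x≢i ∘ toℕ-injective))

module SkewShape (ν ρ : List ℕ) (dν : Descending ν) (dρ : Descending ρ) where

  inSkew⇒rows : ∀ {r c} → InSkew ν ρ r c → colLength ρ c ≤ r × r < colLength ν c
  inSkew⇒rows (ρr≤c , c<νr) = part≤⇒colLength≤ dρ _ _ ρr≤c , <part⇒<colLength dν _ _ c<νr

  rows⇒inSkew : ∀ {r c} → colLength ρ c ≤ r → r < colLength ν c → InSkew ν ρ r c
  rows⇒inSkew lo≤r r<hi = colLength≤⇒part≤ dρ _ _ lo≤r , <colLength⇒<part dν _ _ r<hi

  colContains⇒columnSet : ∀ {m} (F : Filling m) c i → ColContains ν ρ F c i → columnSet ν ρ F c (toℕ i) ≡ true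
  colContains⇒columnSet F c i (r , inSkew , Frc≡i) =
    ∃⇒image _ _ (column F c) (toℕ i) r (proj₁ (inSkew⇒rows inSkew)) (proj₂ (inSkew⇒rows inSkew)) (cong toℕ Frc≡i)

  columnSet⇒colContains : ∀ {m} (F : Filling m) c i → columnSet ν ρ F c (toℕ i) ≡ true → ColContains ν ρ F c i
  columnSet⇒colContains F c i inSet with image⇒∃ _ _ (column F c) (toℕ i) inSet
  ... | r , lo≤r , r<hi , Frc≡i = r , rows⇒inSkew lo≤r r<hi , toℕ-injective Frc≡i

  increasing-columns : ∀ {m} (F : Filling m) → IsSkewTableau UnbarLe UnbarLt ν ρ F →
                       ∀ c → IncreasingOn (colLength ρ c) (colLength ν c) (column F c)
  increasing-columns F (_ , _ , strict) c r lo≤r 1+r<hi =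
    strict r c (rows⇒inSkew lo≤r (<-trans (n<1+n r) 1+r<hi)) (rows⇒inSkew (≤-trans lo≤r (n≤1+n r)) 1+r<hi)

  decreasing-columns : ∀ {m} (F : Filling m) → IsSkewTableau BarLe BarLt ν ρ F →
                       ∀ c → DecreasingOn (colLength ρ c) (colLength ν c) (column F c)
  decreasing-columns F (_ , _ , strict) c r lo≤r 1+r<hi =
    strict r c (rows⇒inSkew lo≤r (<-trans (n<1+n r) 1+r<hi)) (rows⇒inSkew (≤-trans lo≤r (n≤1+n r)) 1+r<hi)

  colContains? : ∀ {m} (F : Filling m) c i → Dec (ColContains ν ρ F c i)
  colContains? F c i with columnSet ν ρ F c (toℕ i) in inSet
  ... | true  = yes (columnSet⇒colContains F c i inSet)
  ... | false = no λ contains → contradiction (trans (sym inSet) (colContains⇒columnSet F c i contains)) λ ()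

  columnSet-⊆ : ∀ {m} (F G : Filling m) → (∀ c i → ColContains ν ρ F c i → ColContains ν ρ G c i) →
                ∀ c y → columnSet ν ρ F c y ≡ true → columnSet ν ρ G c y ≡ true
  columnSet-⊆ {m} F G F⊆G c y inF = subst (λ z → columnSet ν ρ G c z ≡ true) (toℕ-fromℕ< y<m)
    (colContains⇒columnSet G c i (F⊆G c i (columnSet⇒colContains F c i
      (subst (λ z → columnSet ν ρ F c z ≡ true) (sym (toℕ-fromℕ< y<m)) inF))))
    where
    y<m : y < m
    y<m = image-bounded (colLength ρ c) (colLength ν c) (column F c) m (λ r _ _ → toℕ<n (F r c)) y inF
    i = Fin.fromℕ< y<m

  columnSet-≡ : ∀ {m} (F G : Filling m) → (∀ c i → ColContains ν ρ F c i ⇔ ColContains ν ρ G c i) →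
                ∀ c y → columnSet ν ρ F c y ≡ columnSet ν ρ G c y
  columnSet-≡ F G F⇔G c y = bool-ext (columnSet-⊆ F G (λ c i → Equivalence.to (F⇔G c i)) c y)
                                     (columnSet-⊆ G F (λ c i → Equivalence.from (F⇔G c i)) c y)

  increasing-determined : ∀ {m} (F G : Filling m) → IsSkewTableau UnbarLe UnbarLt ν ρ F → IsSkewTableau UnbarLe UnbarLt ν ρ G →
                          (∀ c i → ColContains ν ρ F c i ⇔ ColContains ν ρ G c i) → SameOn ν ρ F G
  increasing-determined {m} F G tabF tabG F⇔G r c inSkew = toℕ-injective (begin
      column F c r                                   ≡⟨ as-nth F tabF ⟩
      nth m (columnSet ν ρ F c) (r ∸ colLength ρ c)  ≡⟨ nth-cong m _ (columnSet-≡ F G F⇔G c) ⟩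
      nth m (columnSet ν ρ G c) (r ∸ colLength ρ c)  ≡⟨ sym (as-nth G tabG) ⟩
      column G c r                                   ∎)
    where
    open ≡-Reasoning
    as-nth : ∀ H → IsSkewTableau UnbarLe UnbarLt ν ρ H → column H c r ≡ nth m (columnSet ν ρ H c) (r ∸ colLength ρ c)
    as-nth H tabH = increasing≡nth m (increasing-columns H tabH c) (λ r _ _ → toℕ<n (H r c)) r
                                   (proj₁ (inSkew⇒rows inSkew)) (proj₂ (inSkew⇒rows inSkew))

  decreasing-determined : ∀ {m} (F G : Filling m) → IsSkewTableau BarLe BarLt ν ρ F → IsSkewTableau BarLe BarLt ν ρ G →
                          (∀ c i → ColContains ν ρ F c i ⇔ ColContains ν ρ G c i) → SameOn ν ρ F G
  decreasing-determined {m} F G tabF tabG F⇔G r c inSkew = toℕ-injective (begin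
      column F c r                                       ≡⟨ as-nth F tabF ⟩
      nth m (columnSet ν ρ F c) (colLength ν c ∸ suc r)  ≡⟨ nth-cong m _ (columnSet-≡ F G F⇔G c) ⟩
      nth m (columnSet ν ρ G c) (colLength ν c ∸ suc r)  ≡⟨ sym (as-nth G tabG) ⟩
      column G c r                                       ∎)
    where
    open ≡-Reasoning
    as-nth : ∀ H → IsSkewTableau BarLe BarLt ν ρ H → column H c r ≡ nth m (columnSet ν ρ H c) (colLength ν c ∸ suc r)
    as-nth H tabH = decreasing≡nth m (decreasing-columns H tabH c) (λ r _ _ → toℕ<n (H r c)) r
                                   (proj₁ (inSkew⇒rows inSkew)) (proj₂ (inSkew⇒rows inSkew))

  -- Swap the row and column sums; each column contains i at most once.
  occ≡count-columns : ∀ {m} (F : Filling m) → (∀ c → InjectiveOn (colLength ρ c) (colLength ν c) (column F c)) →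
                      ∀ W → part ν 0 ≤ W → ∀ i → occ ν ρ F i ≡ count W (λ c → columnSet ν ρ F c (toℕ i))
  occ≡count-columns F inj W νwidth≤W i = begin
      occ ν ρ F i
    ≡⟨ sumTo-cong R (λ r _ → trans (sym (count-restrict W _ (≤-trans (part≤part0 dν r) νwidth≤W))) (count≡sumTo W _)) ⟩
      sumTo R (λ r → sumTo W (λ c → χ (cell r c)))
    ≡⟨ sumTo-swap R W (λ r c → χ (cell r c)) ⟩
      sumTo W (λ c → sumTo R (λ r → χ (cell r c)))
    ≡⟨ sumTo-cong W (λ c _ → trans (sym (count≡sumTo R (λ r → cell r c))) (count-column c)) ⟩
      sumTo W (λ c → χ (columnSet ν ρ F c (toℕ i)))
    ≡⟨ sym (count≡sumTo W _) ⟩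
      count W (λ c → columnSet ν ρ F c (toℕ i)) ∎
    where
    open ≡-Reasoning
    R = length ν
    cell : ℕ → ℕ → Bool
    cell r c = (c <ᵇ part ν r) ∧ ((part ρ r ≤ᵇ c) ∧ ⌊ F r c ≟ i ⌋)
    cell-by-rows : ∀ r c → cell r c ≡ ((r <ᵇ colLength ν c) ∧ ((colLength ρ c ≤ᵇ r) ∧ (column F c r ≡ᵇ toℕ i)))
    cell-by-rows r c = cong₂ _∧_
      (bool-ext (λ c<ᵇνr → <⇒<ᵇ≡true (<part⇒<colLength dν c r (<ᵇ≡true⇒< c<ᵇνr)))
                (λ r<ᵇlen → <⇒<ᵇ≡true (<colLength⇒<part dν c r (<ᵇ≡true⇒< r<ᵇlen))))
      (cong₂ _∧_ (bool-ext (λ ρr≤ᵇc → ≤⇒≤ᵇ≡true (part≤⇒colLength≤ dρ c r (≤ᵇ≡true⇒≤ ρr≤ᵇc)))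
                           (λ len≤ᵇr → ≤⇒≤ᵇ≡true (colLength≤⇒part≤ dρ c r (≤ᵇ≡true⇒≤ len≤ᵇr))))
                 (⌊≟⌋≡≡ᵇ (F r c) i))
    at-most-once : ∀ c → ∀ r r' → r < colLength ν c → r' < colLength ν c →
                   ((colLength ρ c ≤ᵇ r) ∧ (column F c r ≡ᵇ toℕ i)) ≡ true →
                   ((colLength ρ c ≤ᵇ r') ∧ (column F c r' ≡ᵇ toℕ i)) ≡ true → r ≡ r'
    at-most-once c r r' r<hi r'<hi hit hit' = inj c r r' (≤ᵇ≡true⇒≤ (∧-trueˡ hit)) r<hi (≤ᵇ≡true⇒≤ (∧-trueˡ hit')) r'<hi
      (trans (≡ᵇ≡true⇒≡ (∧-trueʳ {colLength ρ c ≤ᵇ r} hit)) (sym (≡ᵇ≡true⇒≡ (∧-trueʳ {colLength ρ c ≤ᵇ r'} hit'))))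
    count-column : ∀ c → count R (λ r → cell r c) ≡ χ (columnSet ν ρ F c (toℕ i))
    count-column c = trans (count-cong R (λ r _ → cell-by-rows r c))
      (trans (count-restrict R _ (colLength≤length ν c)) (≤1⇒≡χ _ (count≤1 _ _ (at-most-once c))))

complement : ℕ → (ℕ → Bool) → ℕ → Bool
complement k P y = (y <ᵇ k) ∧ not (P y)

complement-bounded : ∀ k P y → complement k P y ≡ true → y < k
complement-bounded k P y inC = <ᵇ≡true⇒< (∧-trueˡ inC)

χ-complement : ∀ k P → (∀ y → P y ≡ true → y < k) → ∀ y → χ (complement k P y) + χ (P y) ≡ χ (y <ᵇ k)
χ-complement k P bound y with y <? k
... | yes y<k rewrite <⇒<ᵇ≡true y<k with P y
...   | true  = refl
...   | false = refl
χ-complement k P bound y | no y≮k rewrite ≮⇒<ᵇ≡false y≮k = cong χ (¬-not (y≮k ∘ bound y))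

complement-excludes : ∀ k P y → complement k P y ≡ true → P y ≡ true → ⊥
complement-excludes k P y inC Py = contradiction (subst (λ v → not v ≡ true) Py (∧-trueʳ {y <ᵇ k} inC)) λ ()

complement-includes : ∀ k P y → y < k → P y ≡ false → complement k P y ≡ true
complement-includes k P y y<k Py = ∧-true (<⇒<ᵇ≡true y<k) (cong not Py)

count-complement : ∀ k P → (∀ y → P y ≡ true → y < k) → ∀ x → x ≤ k → count x (complement k P) + count x P ≡ x
count-complement k P bound x x≤k = trans
  (count-+ x (λ y y<x → trans (χ-complement k P bound y) (cong χ (<⇒<ᵇ≡true (<-≤-trans y<x x≤k)))))
  (count-all x (λ _ _ → refl))

count-complement-beyond : ∀ k P n → k ≤ n → count n (complement k P) ≡ count k (complement k P)
count-complement-beyond k P n k≤n = count-stable n _ k≤n (λ y k≤y _ → cong (_∧ not (P y)) (≮⇒<ᵇ≡false (≤⇒≯ k≤y)))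

-- Where g ≤ f on the common rows, a row of f with a value below x is either a row of g with a
-- value below x, or one of the rows of f that g lacks.
countBelow-dominated-below : ∀ lo₀ hi₀ lo₁ hi₁ f g x → lo₁ ≤ lo₀ → hi₁ ≤ hi₀ →
  (∀ r → lo₀ ≤ r → r < hi₁ → g r ≤ f r) →
  countBelow lo₀ hi₀ f x + hi₁ ≤ countBelow lo₁ hi₁ g x + hi₀
countBelow-dominated-below lo₀ hi₀ lo₁ hi₁ f g x lo₁≤lo₀ hi₁≤hi₀ g≤f =
  ≤-trans (count-growth hi₀ _ hi₁≤hi₀) (+-monoˡ-≤ hi₀ (count-⊆ hi₁ below))
  where
  below : ∀ r → r < hi₁ → ((lo₀ ≤ᵇ r) ∧ (f r <ᵇ x)) ≡ true → ((lo₁ ≤ᵇ r) ∧ (g r <ᵇ x)) ≡ true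
  below r r<hi₁ hit = let lo₀≤r = ≤ᵇ≡true⇒≤ (∧-trueˡ hit) in
    ∧-true (≤⇒≤ᵇ≡true (≤-trans lo₁≤lo₀ lo₀≤r))
           (<⇒<ᵇ≡true (≤-<-trans (g≤f r lo₀≤r r<hi₁) (<ᵇ≡true⇒< {f r} {x} (∧-trueʳ {lo₀ ≤ᵇ r} hit))))

countBelow-dominated-above : ∀ lo₀ hi₀ lo₁ hi₁ f g x → lo₁ ≤ lo₀ → hi₁ ≤ hi₀ →
  (∀ r → lo₀ ≤ r → r < hi₁ → g r ≤ f r) →
  countBelow lo₁ hi₁ f x + lo₁ ≤ countBelow lo₀ hi₀ g x + lo₀
countBelow-dominated-above lo₀ hi₀ lo₁ hi₁ f g x lo₁≤lo₀ hi₁≤hi₀ g≤f = begin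
    countBelow lo₁ hi₁ f x + lo₁                        ≤⟨ +-monoˡ-≤ lo₁ (count-∪ hi₁ _ common extra split) ⟩
    count hi₁ common + count hi₁ extra + lo₁            ≡⟨ +-assoc (count hi₁ common) _ lo₁ ⟩
    count hi₁ common + (count hi₁ extra + lo₁)          ≤⟨ +-monoʳ-≤ (count hi₁ common) (count-interval≤ hi₁ lo₁ lo₀ lo₁≤lo₀) ⟩
    count hi₁ common + lo₀                              ≤⟨ +-monoˡ-≤ lo₀ (≤-trans (count-⊆ hi₁ below) (count-mono _ hi₁≤hi₀)) ⟩
    countBelow lo₀ hi₀ g x + lo₀                        ∎
  where
  open ≤-Reasoning
  common extra : ℕ → Bool
  common r = (lo₀ ≤ᵇ r) ∧ (f r <ᵇ x)
  extra  r = (lo₁ ≤ᵇ r) ∧ (r <ᵇ lo₀)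
  split : ∀ r → r < hi₁ → ((lo₁ ≤ᵇ r) ∧ (f r <ᵇ x)) ≡ true → common r ≡ true ⊎ extra r ≡ true
  split r _ hit with lo₀ ≤? r
  ... | yes lo₀≤r = inj₁ (∧-true (≤⇒≤ᵇ≡true lo₀≤r) (∧-trueʳ {lo₁ ≤ᵇ r} hit))
  ... | no lo₀≰r  = inj₂ (∧-true (∧-trueˡ hit) (<⇒<ᵇ≡true (≰⇒> lo₀≰r)))
  below : ∀ r → r < hi₁ → common r ≡ true → ((lo₀ ≤ᵇ r) ∧ (g r <ᵇ x)) ≡ true
  below r r<hi₁ hit = let lo₀≤r = ≤ᵇ≡true⇒≤ (∧-trueˡ hit) in
    ∧-true (∧-trueˡ hit) (<⇒<ᵇ≡true (≤-<-trans (g≤f r lo₀≤r r<hi₁) (<ᵇ≡true⇒< {f r} {x} (∧-trueʳ {lo₀ ≤ᵇ r} hit))))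

toFin : ∀ {m} → ℕ → Fin (suc m)
toFin {m} y with y <? suc m
... | yes y<1+m = Fin.fromℕ< y<1+m
... | no _      = Fin.zero

toℕ-toFin : ∀ {m y} → y < suc m → toℕ (toFin {m} y) ≡ y
toℕ-toFin {m} {y} y<1+m with y <? suc m
... | yes _   = toℕ-fromℕ< _
... | no y≮1+m = contradiction y<1+m y≮1+m

-- The bijection

module Bijection (m′ : ℕ) (a : Vec ℕ (suc m′)) (lam : List ℕ) (b : Vec ℕ (suc m′)) (mu : List ℕ)
                 (dλ : Descending lam) (dμ : Descending mu) (dom : Dominant a) where

  m : ℕ
  m = suc m′

  ν : List ℕ
  ν = a ∪ₚ lam

  dν : Descending ν
  dν = sortDesc-descending (Vec.toList a ++ lam)

  da : Descending (Vec.toList a)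
  da = dominant⇒descending a dom

  L M N : ℕ → ℕ
  L = colLength lam
  M = colLength mu
  N = colLength ν

  -- As a is decreasing, column c may contain exactly the letters i < allowed c.
  allowed : ℕ → ℕ
  allowed = colLength (Vec.toList a)

  N≡allowed+L : ∀ c → N c ≡ allowed c + L c
  N≡allowed+L c = trans (colLength-sortDesc (Vec.toList a ++ lam) c) (colLength-++ (Vec.toList a) lam c)

  <allowed⇒<a : ∀ (i : Fin m) c → toℕ i < allowed c → c < Vec.lookup a i
  <allowed⇒<a i c i<allowed = subst (c <_) (part-toList a i) (<colLength⇒<part da c (toℕ i) i<allowed)

  <a⇒<allowed : ∀ (i : Fin m) c → c < Vec.lookup a i → toℕ i < allowed c
  <a⇒<allowed i c c<aᵢ = <part⇒<colLength da c (toℕ i) (subst (c <_) (sym (part-toList a i)) c<aᵢ)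

  allowed≤m : ∀ c → allowed c ≤ m
  allowed≤m c = subst (allowed c ≤_) (length-toList a) (colLength≤length (Vec.toList a) c)

  module Bar   = SkewShape mu lam dμ dλ
  module Unbar = SkewShape ν mu dν dμ

  count-columns-complementary : ∀ (P Q : ℕ → ℕ → Bool) → (∀ c y → χ (P c y) + χ (Q c y) ≡ χ (y <ᵇ allowed c)) →
    ∀ (i : Fin m) W → Vec.lookup a i ≤ W →
    count W (λ c → P c (toℕ i)) + count W (λ c → Q c (toℕ i)) ≡ Vec.lookup a i
  count-columns-complementary P Q PQ i W aᵢ≤W =
    trans (count-+ W (λ c _ → trans (PQ c (toℕ i)) (cong χ (<ᵇallowed≡<ᵇa c)))) (count-below W _ aᵢ≤W)
    where
    <ᵇallowed≡<ᵇa : ∀ c → (toℕ i <ᵇ allowed c) ≡ (c <ᵇ Vec.lookup a i)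
    <ᵇallowed≡<ᵇa c = bool-ext (<⇒<ᵇ≡true ∘ <allowed⇒<a i c ∘ <ᵇ≡true⇒<) (<⇒<ᵇ≡true ∘ <a⇒<allowed i c ∘ <ᵇ≡true⇒<)

  width : Fin m → ℕ
  width i = part ν 0 + part mu 0 + Vec.lookup a i

  νwidth≤width : ∀ i → part ν 0 ≤ width i
  νwidth≤width i = ≤-trans (m≤m+n (part ν 0) (part mu 0)) (m≤m+n _ _)

  μwidth≤width : ∀ i → part mu 0 ≤ width i
  μwidth≤width i = ≤-trans (m≤n+m (part mu 0) (part ν 0)) (m≤m+n _ _)

  aᵢ≤width : ∀ i → Vec.lookup a i ≤ width i
  aᵢ≤width i = m≤n+m _ _

  -- Column c of T = 𝔟(T̄) consists of the allowed letters missing from column c of T̄, in increasing order.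
  module Forward (Tbar : Filling m) (Tbar∈S̄ : SbarSet a lam b mu Tbar) where

    B : ℕ → ℕ → Bool
    B = columnSet mu lam Tbar

    injective-B : ∀ c → InjectiveOn (L c) (M c) (column Tbar c)
    injective-B c = decreasing⇒injective (Bar.decreasing-columns Tbar (proj₁ Tbar∈S̄) c)

    Tbar<allowed : ∀ c r → L c ≤ r → r < M c → column Tbar c r < allowed c
    Tbar<allowed c r L≤r r<M = <a⇒<allowed (Tbar r c) c (proj₂ (proj₂ Tbar∈S̄) (Tbar r c) r c (Bar.rows⇒inSkew L≤r r<M) refl)

    B-bounded : ∀ c y → B c y ≡ true → y < allowed c
    B-bounded c = image-bounded (L c) (M c) (column Tbar c) (allowed c) (Tbar<allowed c)

    L≤M : ∀ c → L c ≤ M c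
    L≤M = colLength-mono dλ dμ (proj₁ (proj₁ Tbar∈S̄))

    B-size : ∀ c → count (allowed c) (B c) + L c ≡ M c
    B-size c = count-image-size (L c) (M c) (column Tbar c) (allowed c) (L≤M c) (injective-B c) (Tbar<allowed c)

    C : ℕ → ℕ → Bool
    C c = complement (allowed c) (B c)

    C-bounded : ∀ c y → C c y ≡ true → y < allowed c
    C-bounded c = complement-bounded (allowed c) (B c)

    CB-sum : ∀ c x → x ≤ allowed c → count x (C c) + count x (B c) ≡ x
    CB-sum c = count-complement (allowed c) (B c) (B-bounded c)

    M≤N : ∀ c → M c ≤ N c
    M≤N c = subst₂ _≤_ (B-size c) (sym (N≡allowed+L c)) (+-monoˡ-≤ (L c) (count≤n (allowed c) (B c)))

    C-size : ∀ c → count m (C c) + M c ≡ N c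
    C-size c = begin
        count m (C c) + M c                                      ≡⟨ cong₂ _+_ (count-complement-beyond (allowed c) (B c) m (allowed≤m c)) (sym (B-size c)) ⟩
        count (allowed c) (C c) + (count (allowed c) (B c) + L c) ≡⟨ sym (+-assoc (count (allowed c) (C c)) _ _) ⟩
        count (allowed c) (C c) + count (allowed c) (B c) + L c   ≡⟨ cong (_+ L c) (CB-sum c (allowed c) ≤-refl) ⟩
        allowed c + L c                                          ≡⟨ sym (N≡allowed+L c) ⟩
        N c                                                      ∎
      where open ≡-Reasoning

    t : ℕ → ℕ → ℕ
    t r c = nth m (C c) (r ∸ M c)

    T : Filling m
    T r c = toFin (t r c)

    column-T : ∀ c r → M c ≤ r → r < N c → column T c r ≡ t r c
    column-T c r M≤r r<N = toℕ-toFin (Nth.nth< m (C c) (index<-increasing M≤r r<N (C-size c)))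

    columnSet-T : ∀ c y → columnSet ν mu T c y ≡ C c y
    columnSet-T c y = trans (image-cong (M c) (N c) (column-T c) y)
      (nth-image-increasing m (C c) (M c) (N c) (λ y' Cy' → <-≤-trans (C-bounded c y' Cy') (allowed≤m c)) (C-size c) y)

    increasing-T : ∀ c → IncreasingOn (M c) (N c) (column T c)
    increasing-T c r M≤r 1+r<N =
      subst₂ _<_ (sym (column-T c r M≤r (<-trans (n<1+n r) 1+r<N))) (sym (column-T c (suc r) (≤-trans M≤r (n≤1+n r)) 1+r<N))
        (nth-increasing m (C c) (M c) (N c) (C-size c) r M≤r 1+r<N)

    -- A descent t r (c+1) < t r c would put more letters below x = t r (c+1) + 1 into column c+1 of T
    -- than into column c (relative to their top rows), hence fewer into column c+1 of T̄, against the
    -- rows of T̄.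
    rows-T : ∀ r c → M c ≤ r → r < N c → M (suc c) ≤ r → r < N (suc c) → t r c ≤ t r (suc c)
    rows-T r c M₀≤r r<N₀ M₁≤r r<N₁ = ≮⇒≥ λ descent →
      no-descent {count x (C c)} {count x (B c)} {count x (C c₁)} {count x (B c₁)} {M c} {M c₁}
        (trans (CB-sum c x x≤allowed₀) (sym (CB-sum c₁ x x≤allowed₁)))
        (≤-trans (+-monoˡ-≤ (M c) (Nth.count≤index m (C c) j₀<count descent)) (≤-reflexive (m∸n+n≡m M₀≤r)))
        (trans (cong (_+ M c₁) (Nth.count-suc-nth m (C c₁) j₁<count)) (cong suc (m∸n+n≡m M₁≤r)))
        B-rows
      where
      c₁ = suc c
      j₀<count = index<-increasing M₀≤r r<N₀ (C-size c)
      j₁<count = index<-increasing M₁≤r r<N₁ (C-size c₁)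
      x = suc (t r c₁)
      x≤allowed₁ : x ≤ allowed c₁
      x≤allowed₁ = C-bounded c₁ _ (Nth.nth-true m (C c₁) j₁<count)
      x≤allowed₀ : x ≤ allowed c
      x≤allowed₀ = ≤-trans x≤allowed₁ (colLength-suc (Vec.toList a) c)
      rows-Tbar : ∀ r → L c ≤ r → r < M c₁ → column Tbar c₁ r ≤ column Tbar c r
      rows-Tbar r L₀≤r r<M₁ = proj₁ (proj₂ (proj₁ Tbar∈S̄)) r c
        (Bar.rows⇒inSkew L₀≤r (<-≤-trans r<M₁ (colLength-suc mu c))) (Bar.rows⇒inSkew (≤-trans (colLength-suc lam c) L₀≤r) r<M₁)
      B-rows : count x (B c) + M c₁ ≤ count x (B c₁) + M c
      B-rows = subst₂ (λ u v → u + M c₁ ≤ v + M c) (sym (count-image _ _ _ (injective-B c) x)) (sym (count-image _ _ _ (injective-B c₁) x))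
        (countBelow-dominated-below (L c) (M c) (L c₁) (M c₁) (column Tbar c) (column Tbar c₁) x
          (colLength-suc lam c) (colLength-suc mu c) rows-Tbar)
      no-descent : ∀ {C₀ B₀ C₁ B₁ M₀ M₁} → C₀ + B₀ ≡ C₁ + B₁ →
                   C₀ + M₀ ≤ r → C₁ + M₁ ≡ suc r → B₀ + M₁ ≤ B₁ + M₀ → ⊥
      no-descent {C₀} {B₀} {C₁} {B₁} {M₀} {M₁} CB₀≡CB₁ CM₀≤r CM₁≡1+r BM = <-irrefl refl (begin-strict
          r + (B₁ + M₀)            <⟨ n<1+n _ ⟩
          suc r + (B₁ + M₀)        ≡⟨ cong (_+ (B₁ + M₀)) (sym CM₁≡1+r) ⟩
          C₁ + M₁ + (B₁ + M₀)      ≡⟨ interchange C₁ M₁ B₁ M₀ ⟩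
          C₁ + B₁ + (M₁ + M₀)      ≡⟨ cong₂ _+_ (sym CB₀≡CB₁) (+-comm M₁ M₀) ⟩
          C₀ + B₀ + (M₀ + M₁)      ≡⟨ interchange C₀ B₀ M₀ M₁ ⟩
          C₀ + M₀ + (B₀ + M₁)      ≤⟨ +-mono-≤ CM₀≤r BM ⟩
          r + (B₁ + M₀)            ∎)
        where open ≤-Reasoning

    tableau-T : IsSkewTableau UnbarLe UnbarLt ν mu T
    tableau-T = colLength-mono⇒part≤ dμ dν M≤N
      , (λ r c s₀ s₁ → let (M₀≤r , r<N₀) = Unbar.inSkew⇒rows s₀ ; (M₁≤r , r<N₁) = Unbar.inSkew⇒rows s₁ in
           subst₂ _≤_ (sym (column-T c r M₀≤r r<N₀)) (sym (column-T (suc c) r M₁≤r r<N₁)) (rows-T r c M₀≤r r<N₀ M₁≤r r<N₁))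
      , (λ r c s₀ s₁ → increasing-T c r (proj₁ (Unbar.inSkew⇒rows s₀)) (proj₂ (Unbar.inSkew⇒rows s₁)))

    occ-T : ∀ i → occ ν mu T i ≡ Vec.lookup b i
    occ-T i = +-cancelʳ-≡ (occ mu lam Tbar i) _ _ (begin
        occ ν mu T i + occ mu lam Tbar i
      ≡⟨ cong₂ _+_ (trans (Unbar.occ≡count-columns T (λ c → increasing⇒injective (increasing-T c)) (width i) (νwidth≤width i) i)
                          (count-cong (width i) (λ c _ → columnSet-T c (toℕ i))))
                   (Bar.occ≡count-columns Tbar injective-B (width i) (μwidth≤width i) i) ⟩
        count (width i) (λ c → C c (toℕ i)) + count (width i) (λ c → B c (toℕ i))
      ≡⟨ count-columns-complementary C B (λ c → χ-complement (allowed c) (B c) (B-bounded c)) i (width i) (aᵢ≤width i) ⟩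
        Vec.lookup a i
      ≡⟨ sym (proj₁ (proj₂ Tbar∈S̄) i) ⟩
        occ mu lam Tbar i + Vec.lookup b i
      ≡⟨ +-comm (occ mu lam Tbar i) _ ⟩
        Vec.lookup b i + occ mu lam Tbar i ∎)
      where open ≡-Reasoning

    colContains-T⇒C : ∀ c i → ColContains ν mu T c i → C c (toℕ i) ≡ true
    colContains-T⇒C c i contains = trans (sym (columnSet-T c (toℕ i))) (Unbar.colContains⇒columnSet T c i contains)

    within-T : WithinCols a ν mu T
    within-T i r c inSkew Trc≡i = <allowed⇒<a i c (C-bounded c (toℕ i) (colContains-T⇒C c i (r , inSkew , Trc≡i)))

    T-is-𝔟 : IsB a lam mu Tbar T
    T-is-𝔟 i c = mk⇔
      (λ contains → <allowed⇒<a i c (C-bounded c (toℕ i) (colContains-T⇒C c i contains))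
                  , complement-excludes (allowed c) (B c) (toℕ i) (colContains-T⇒C c i contains) ∘ Bar.colContains⇒columnSet Tbar c i)
      (λ (c<aᵢ , ¬containsBar) → Unbar.columnSet⇒colContains T c i (trans (columnSet-T c (toℕ i))
        (complement-includes (allowed c) (B c) (toℕ i) (<a⇒<allowed i c c<aᵢ) (¬-not (¬containsBar ∘ Bar.columnSet⇒colContains Tbar c i)))))

  -- Column c of the preimage T̄ consists of the allowed letters missing from column c of T, in decreasing order.
  module Backward (T : Filling m) (T∈S : SSet a lam b mu T) where

    C : ℕ → ℕ → Bool
    C = columnSet ν mu T

    injective-C : ∀ c → InjectiveOn (M c) (N c) (column T c)
    injective-C c = increasing⇒injective (Unbar.increasing-columns T (proj₁ T∈S) c)

    T<allowed : ∀ c r → M c ≤ r → r < N c → column T c r < allowed c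
    T<allowed c r M≤r r<N = <a⇒<allowed (T r c) c (proj₂ (proj₂ T∈S) (T r c) r c (Unbar.rows⇒inSkew M≤r r<N) refl)

    C-bounded : ∀ c y → C c y ≡ true → y < allowed c
    C-bounded c = image-bounded (M c) (N c) (column T c) (allowed c) (T<allowed c)

    M≤N : ∀ c → M c ≤ N c
    M≤N = colLength-mono dμ dν (proj₁ (proj₁ T∈S))

    C-size : ∀ c → count (allowed c) (C c) + M c ≡ N c
    C-size c = count-image-size (M c) (N c) (column T c) (allowed c) (M≤N c) (injective-C c) (T<allowed c)

    B : ℕ → ℕ → Bool
    B c = complement (allowed c) (C c)

    BC-sum : ∀ c x → x ≤ allowed c → count x (B c) + count x (C c) ≡ x
    BC-sum c = count-complement (allowed c) (C c) (C-bounded c)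

    B-size-allowed : ∀ c → count (allowed c) (B c) + L c ≡ M c
    B-size-allowed c = +-cancelˡ-≡ (count (allowed c) (C c)) _ _ (begin
        count (allowed c) (C c) + (count (allowed c) (B c) + L c) ≡⟨ x∙yz≈yx∙z (count (allowed c) (C c)) _ (L c) ⟩
        count (allowed c) (B c) + count (allowed c) (C c) + L c   ≡⟨ cong (_+ L c) (BC-sum c (allowed c) ≤-refl) ⟩
        allowed c + L c                                          ≡⟨ sym (N≡allowed+L c) ⟩
        N c                                                      ≡⟨ sym (C-size c) ⟩
        count (allowed c) (C c) + M c                            ∎)
      where open ≡-Reasoning

    L≤M : ∀ c → L c ≤ M c
    L≤M c = subst (L c ≤_) (B-size-allowed c) (m≤n+m (L c) _)

    B-size : ∀ c → count m (B c) + L c ≡ M c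
    B-size c = trans (cong (_+ L c) (count-complement-beyond (allowed c) (C c) m (allowed≤m c))) (B-size-allowed c)

    t̄ : ℕ → ℕ → ℕ
    t̄ r c = nth m (B c) (M c ∸ suc r)

    Tbar : Filling m
    Tbar r c = toFin (t̄ r c)

    column-Tbar : ∀ c r → L c ≤ r → r < M c → column Tbar c r ≡ t̄ r c
    column-Tbar c r L≤r r<M = toℕ-toFin (Nth.nth< m (B c) (index<-decreasing L≤r r<M (B-size c)))

    columnSet-Tbar : ∀ c y → columnSet mu lam Tbar c y ≡ B c y
    columnSet-Tbar c y = trans (image-cong (L c) (M c) (column-Tbar c) y)
      (nth-image-decreasing m (B c) (L c) (M c) (λ y' By' → <-≤-trans (complement-bounded (allowed c) (C c) y' By') (allowed≤m c)) (B-size c) y)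

    decreasing-Tbar : ∀ c → DecreasingOn (L c) (M c) (column Tbar c)
    decreasing-Tbar c r L≤r 1+r<M =
      subst₂ _<_ (sym (column-Tbar c (suc r) (≤-trans L≤r (n≤1+n r)) 1+r<M)) (sym (column-Tbar c r L≤r (<-trans (n<1+n r) 1+r<M)))
        (nth-decreasing m (B c) (L c) (M c) (B-size c) r L≤r 1+r<M)

    -- An ascent t̄ r c < t̄ r (c+1) would put more letters below x = t̄ r c + 1 into column c of T̄
    -- than into column c+1, hence fewer into column c of T, against the rows of T.  If x exceeds the
    -- letters allowed in column c+1, column c+1 of T̄ is too short to hold the ascent at all.
    rows-Tbar : ∀ r c → L c ≤ r → r < M c → L (suc c) ≤ r → r < M (suc c) → t̄ r (suc c) ≤ t̄ r c
    rows-Tbar r c L₀≤r r<M₀ L₁≤r r<M₁ = ≮⇒≥ ascent⇒⊥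
      where
      c₁ = suc c
      j₀<count = index<-decreasing L₀≤r r<M₀ (B-size c)
      j₁<count = index<-decreasing L₁≤r r<M₁ (B-size c₁)
      x = suc (t̄ r c)
      B₀-count : count x (B c) + r ≡ M c
      B₀-count = trans (cong (_+ r) (Nth.count-suc-nth m (B c) j₀<count)) (trans (sym (+-suc _ r)) (m∸n+n≡m r<M₀))
      B₁-count : t̄ r c < t̄ r c₁ → count x (B c₁) + suc r ≤ M c₁
      B₁-count ascent = ≤-trans (+-monoˡ-≤ (suc r) (Nth.count≤index m (B c₁) j₁<count ascent)) (≤-reflexive (m∸n+n≡m r<M₁))
      rows-T : ∀ r → M c ≤ r → r < N c₁ → column T c r ≤ column T c₁ r
      rows-T r M₀≤r r<N₁ = proj₁ (proj₂ (proj₁ T∈S)) r c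
        (Unbar.rows⇒inSkew M₀≤r (<-≤-trans r<N₁ (colLength-suc ν c))) (Unbar.rows⇒inSkew (≤-trans (colLength-suc mu c) M₀≤r) r<N₁)
      C-rows : count x (C c₁) + M c₁ ≤ count x (C c) + M c
      C-rows = subst₂ (λ u v → u + M c₁ ≤ v + M c) (sym (count-image _ _ _ (injective-C c₁) x)) (sym (count-image _ _ _ (injective-C c) x))
        (countBelow-dominated-above (M c) (N c) (M c₁) (N c₁) (column T c₁) (column T c) x
          (colLength-suc mu c) (colLength-suc ν c) rows-T)
      no-ascent : ∀ {B₀ C₀ B₁ C₁ M₀ M₁} → B₀ + C₀ ≡ B₁ + C₁ →
                  B₀ + r ≡ M₀ → B₁ + suc r ≤ M₁ → C₁ + M₁ ≤ C₀ + M₀ → ⊥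
      no-ascent {B₀} {C₀} {B₁} {C₁} {M₀} {M₁} BC₀≡BC₁ BM₀ BM₁ CM = <-irrefl refl (begin-strict
          B₁ + C₁ + r         <⟨ +-monoʳ-< (B₁ + C₁) (n<1+n r) ⟩
          B₁ + C₁ + suc r     ≡⟨ xy∙z≈xz∙y B₁ C₁ (suc r) ⟩
          B₁ + suc r + C₁     ≤⟨ +-monoˡ-≤ C₁ BM₁ ⟩
          M₁ + C₁             ≡⟨ +-comm M₁ C₁ ⟩
          C₁ + M₁             ≤⟨ CM ⟩
          C₀ + M₀             ≡⟨ cong (C₀ +_) (sym BM₀) ⟩
          C₀ + (B₀ + r)       ≡⟨ x∙yz≈yx∙z C₀ B₀ r ⟩
          B₀ + C₀ + r         ≡⟨ cong (_+ r) BC₀≡BC₁ ⟩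
          B₁ + C₁ + r         ∎)
        where open ≤-Reasoning
      ascent⇒⊥ : t̄ r c < t̄ r c₁ → ⊥
      ascent⇒⊥ ascent with x ≤? allowed c₁
      ... | yes x≤allowed₁ = no-ascent {count x (B c)} {count x (C c)} {count x (B c₁)} {count x (C c₁)} {M c} {M c₁}
                                       (trans (BC-sum c x (≤-trans x≤allowed₁ (colLength-suc (Vec.toList a) c))) (sym (BC-sum c₁ x x≤allowed₁)))
                                       B₀-count (B₁-count ascent) C-rows
      ... | no x≰allowed₁ = <-irrefl refl (begin-strict
            M c₁                             ≡⟨ sym (B-size-allowed c₁) ⟩
            count (allowed c₁) (B c₁) + L c₁ ≤⟨ +-mono-≤ (count-mono (B c₁) (<⇒≤ (≰⇒> x≰allowed₁))) L₁≤r ⟩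
            count x (B c₁) + r               <⟨ +-monoʳ-< (count x (B c₁)) (n<1+n r) ⟩
            count x (B c₁) + suc r           ≤⟨ B₁-count ascent ⟩
            M c₁                             ∎)
        where open ≤-Reasoning

    tableau-Tbar : IsSkewTableau BarLe BarLt mu lam Tbar
    tableau-Tbar = colLength-mono⇒part≤ dλ dμ L≤M
      , (λ r c s₀ s₁ → let (L₀≤r , r<M₀) = Bar.inSkew⇒rows s₀ ; (L₁≤r , r<M₁) = Bar.inSkew⇒rows s₁ in
           subst₂ _≤_ (sym (column-Tbar (suc c) r L₁≤r r<M₁)) (sym (column-Tbar c r L₀≤r r<M₀)) (rows-Tbar r c L₀≤r r<M₀ L₁≤r r<M₁))
      , (λ r c s₀ s₁ → decreasing-Tbar c r (proj₁ (Bar.inSkew⇒rows s₀)) (proj₂ (Bar.inSkew⇒rows s₁)))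

    occ-Tbar : ∀ i → occ mu lam Tbar i + Vec.lookup b i ≡ Vec.lookup a i
    occ-Tbar i = begin
        occ mu lam Tbar i + Vec.lookup b i
      ≡⟨ cong₂ _+_ (trans (Bar.occ≡count-columns Tbar (λ c → decreasing⇒injective (decreasing-Tbar c)) (width i) (μwidth≤width i) i)
                          (count-cong (width i) (λ c _ → columnSet-Tbar c (toℕ i))))
                   (trans (sym (proj₁ (proj₂ T∈S) i)) (Unbar.occ≡count-columns T injective-C (width i) (νwidth≤width i) i)) ⟩
        count (width i) (λ c → B c (toℕ i)) + count (width i) (λ c → C c (toℕ i))
      ≡⟨ count-columns-complementary B C (λ c → χ-complement (allowed c) (C c) (C-bounded c)) i (width i) (aᵢ≤width i) ⟩
        Vec.lookup a i ∎
      where open ≡-Reasoning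

    colContains-Tbar⇒B : ∀ c i → ColContains mu lam Tbar c i → B c (toℕ i) ≡ true
    colContains-Tbar⇒B c i contains = trans (sym (columnSet-Tbar c (toℕ i))) (Bar.colContains⇒columnSet Tbar c i contains)

    within-Tbar : WithinCols a mu lam Tbar
    within-Tbar i r c inSkew Tbar≡i =
      <allowed⇒<a i c (complement-bounded (allowed c) (C c) (toℕ i) (colContains-Tbar⇒B c i (r , inSkew , Tbar≡i)))

    T-is-𝔟 : IsB a lam mu Tbar T
    T-is-𝔟 i c = mk⇔
      (λ contains → <allowed⇒<a i c (C-bounded c (toℕ i) (Unbar.colContains⇒columnSet T c i contains))
                  , λ containsBar → complement-excludes (allowed c) (C c) (toℕ i) (colContains-Tbar⇒B c i containsBar)
                                                       (Unbar.colContains⇒columnSet T c i contains))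
      (λ (c<aᵢ , ¬containsBar) → decidable-stable (Unbar.colContains? T c i) λ ¬contains →
         ¬containsBar (Bar.columnSet⇒colContains Tbar c i (trans (columnSet-Tbar c (toℕ i))
           (complement-includes (allowed c) (C c) (toℕ i) (<a⇒<allowed i c c<aᵢ)
             (¬-not (¬contains ∘ Unbar.columnSet⇒colContains T c i))))))

  -- Within the first aᵢ columns, T̄ contains i exactly where T = 𝔟(T̄) does not.
  𝔟-injective-columns : ∀ (Tbar Tbar' T : Filling m) → SbarSet a lam b mu Tbar →
    IsB a lam mu Tbar T → IsB a lam mu Tbar' T → ∀ c i → ColContains mu lam Tbar c i → ColContains mu lam Tbar' c i
  𝔟-injective-columns Tbar Tbar' T Tbar∈S̄ T≡𝔟Tbar T≡𝔟Tbar' c i contains@(r , inSkew , Tbar≡i) =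
    decidable-stable (Bar.colContains? Tbar' c i) λ ¬contains' →
      proj₂ (Equivalence.to (T≡𝔟Tbar i c) (Equivalence.from (T≡𝔟Tbar' i c) (c<aᵢ , ¬contains'))) contains
    where
    c<aᵢ : c < Vec.lookup a i
    c<aᵢ = proj₂ (proj₂ Tbar∈S̄) i r c inSkew Tbar≡i

lemma5p4 : (m : ℕ) → 1 ≤ m →
    (a : Vec ℕ m) (lam : List ℕ) (b : Vec ℕ m) (mu : List ℕ) →
    IsPartition lam → IsPartition mu →
    sum a + size lam ≡ sum b + size mu →
    Dominant a →
    -- well-defined: 𝔟(T̄) exists in S_{ΛΩ} ...
    ((Tbar : Filling m) → SbarSet a lam b mu Tbar →
       Σ (Filling m) (λ T → SSet a lam b mu T × IsB a lam mu Tbar T))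
    -- ... and is unique
    × ((Tbar T T' : Filling m) → SbarSet a lam b mu Tbar →
       SSet a lam b mu T → SSet a lam b mu T' →
       IsB a lam mu Tbar T → IsB a lam mu Tbar T' → SameOn (a ∪ₚ lam) mu T T')
    -- injective
    × ((Tbar Tbar' T : Filling m) → SbarSet a lam b mu Tbar → SbarSet a lam b mu Tbar' →
       SSet a lam b mu T →
       IsB a lam mu Tbar T → IsB a lam mu Tbar' T → SameOn mu lam Tbar Tbar')
    -- surjective
    × ((T : Filling m) → SSet a lam b mu T →
       Σ (Filling m) (λ Tbar → SbarSet a lam b mu Tbar × IsB a lam mu Tbar T))
lemma5p4 (suc m′) _ a lam b mu (dλ , _) (dμ , _) _ dom =
    (λ Tbar Tbar∈S̄ → let open Forward Tbar Tbar∈S̄ in T , (tableau-T , occ-T , within-T) , T-is-𝔟)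
  , (λ Tbar T T' _ T∈S T'∈S T≡𝔟 T'≡𝔟 →
       Unbar.increasing-determined T T' (proj₁ T∈S) (proj₁ T'∈S) (λ c i → ⇔-sym (T'≡𝔟 i c) ⇔-∘ T≡𝔟 i c))
  , (λ Tbar Tbar' T Tbar∈S̄ Tbar'∈S̄ _ T≡𝔟 T≡𝔟' →
       Bar.decreasing-determined Tbar Tbar' (proj₁ Tbar∈S̄) (proj₁ Tbar'∈S̄)
         (λ c i → mk⇔ (𝔟-injective-columns Tbar Tbar' T Tbar∈S̄ T≡𝔟 T≡𝔟' c i)
                      (𝔟-injective-columns Tbar' Tbar T Tbar'∈S̄ T≡𝔟' T≡𝔟 c i)))
  , (λ T T∈S → let open Backward T T∈S in Tbar , (tableau-Tbar , occ-Tbar , within-Tbar) , T-is-𝔟)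
  where open Bijection m′ a lam b mu dλ dμ dom
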